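{- The nested sequent calculus $\mathsf{NK}$ for the modal logic $\mathsf{K}$ has the bisimulation nested-sequent uniform interpolation property (BNUIP).
   Context: Modal formulas are in negation normal form: $\varphi ::= \bot \mid \top \mid p \mid \overline{p} \mid (\varphi\land\varphi)\mid(\varphi\lor\varphi)\mid\Box\varphi\mid\Diamond\varphi$. A nested sequent has the form $\varphi_1,\dots,\varphi_n,[\Gamma_1],\dots,[\Gamma_m]$ with the $\Gamma_j$ nested sequents; its formula interpretation is $\varphi_1\lor\dots\lor\varphi_n\lor\Box\iota(\Gamma_1)\lor\dots\lor\Box\iota(\Gamma_m)$. Nodes of the sequent tree are labelled by finite sequences of natural numbers: the root is $1$ and the $i$-th structural box directly inside node $\sigma$ gets label $\sigma * i$; $\mathcal{L}(\Gamma)$ is the set of labels, and $\sigma:\varphi\in\Gamma$ means $\varphi$ occurs directly at node $\sigma$. $\mathsf{NK}$ is Brünnler's terminating (Kleene'd) nested calculus with rules $\mathsf{id_P}$ ($\Gamma\{p,\overline p\}$), $\mathsf{id_\top}$ ($\Gamma\{\top\}$), $\lor$, $\land$, $\Box$ (from $\Gamma\{\Box\varphi,[\varphi]\}$ infer $\Gamma\{\Box\varphi\}$) and $\mathsf{k}$ (from $\Gamma\{\Diamond\varphi,[\Delta,\varphi]\}$ infer $\Gamma\{\Diamond\varphi,[\Delta]\}$); it is sound and complete for $\mathsf{K}$. $\mathsf{K}$-models are finite intransitive, irreflexive directed trees $(W,R,V)$. A multiworld interpretation of $\Gamma$ into a model $\mathcal{M}=(W,R,V)$ is a map $\mathcal{I}:\mathcal{L}(\Gamma)\to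 W$ with $\mathcal{I}(\sigma)R\,\mathcal{I}(\sigma*n)$ whenever both labels are in $\mathcal{L}(\Gamma)$; $\mathcal{M},\mathcal{I}\models\Gamma$ iff $\mathcal{M},\mathcal{I}(\sigma)\models\varphi$ for some $\sigma:\varphi\in\Gamma$. Multiformulas are given by $\mho ::= \sigma:\varphi \mid (\mho \curlywedge \mho) \mid (\mho\curlyvee\mho)$, where $\curlywedge$ and $\curlyvee$ denote multiformula conjunction and disjunction; for $\mathcal{I}$ defined on all labels of $\mho$: $\mathcal{M},\mathcal{I}\models\sigma:\varphi$ iff $\mathcal{M},\mathcal{I}(\sigma)\models\varphi$, $\curlywedge$ is interpreted as "both", $\curlyvee$ as "at least one". A bisimulation up to an atomic proposition $p$ between models $\mathcal{M}$ and $\mathcal{M}'$ is a nonempty relation $Z$ such that related worlds agree on all atoms $q\neq p$ and satisfy the usual forth and back conditions; $(\mathcal{M},\mathcal{I})\sim_p(\mathcal{M}',\mathcal{I}')$ means there is such $Z$ with $\mathcal{I}(\sigma)Z\mathcal{I}'(\sigma)$ for all $\sigma$ in the common domain. A nested calculus $\mathsf{NL}$ sound and complete for logic $\mathsf{L}$ has the BNUIP if for every nested sequent $\Gamma$ and atomic $p$ there is a multiformula $A_p(\Gamma)$ with: (i) $\mathit{Var}(A_p(\Gamma))\subseteq\mathit{Var}(\Gamma)\setminus\{p\}$ and $\mathcal{L}(A_p(\Gamma))\subseteq\mathcal{L}(\Gamma)$; (ii) for every multiworld interpretation $\mathcal{I}$ of $\Gamma$ into an $\mathsf{L}$-model $\mathcal{M}$,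 $\mathcal{M},\mathcal{I}\models A_p(\Gamma)$ implies $\mathcal{M},\mathcal{I}\models\Gamma$; (iii)$'$ for every $\mathsf{L}$-model $\mathcal{M}$ and multiworld interpretation $\mathcal{I}$ of $\Gamma$ into $\mathcal{M}$, if $\mathcal{M},\mathcal{I}\not\models A_p(\Gamma)$ then there are an $\mathsf{L}$-model $\mathcal{M}'$ and a multiworld interpretation $\mathcal{I}'$ of $\Gamma$ into $\mathcal{M}'$ with $(\mathcal{M}',\mathcal{I}')\sim_p(\mathcal{M},\mathcal{I})$ and $\mathcal{M}',\mathcal{I}'\not\models\Gamma$. -}

module Defs where

open import Data.Nat using (ℕ; zero; suc)
open import Data.Bool using (Bool; true; false)
open import Data.Fin using (Fin)
open import Data.List using (List; []; _∷_; _++_; [_])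
open import Data.List.Membership.Propositional using (_∈_)
open import Data.Maybe using (Maybe; just; nothing)
open import Data.Product using (Σ; Σ-syntax; _×_; _,_)
open import Data.Sum using (_⊎_)
open import Data.Empty using (⊥)
open import Data.Unit using (⊤)
open import Relation.Nullary using (¬_)
open import Relation.Binary.PropositionalEquality using (_≡_; _≢_)

-- Modal formulas in negation normal form; atoms are natural numbers.

data Fm : Set where
  ⊥ᶠ ⊤ᶠ : Fm
  var nvar : ℕ → Fm
  _∧ᶠ_ _∨ᶠ_ : Fm → Fm → Fm
  □ᶠ ◇ᶠ : Fm → Fm

data OccFm (q : ℕ) : Fm → Set where
  o-var  : OccFm q (var q)
  o-nvar : OccFm q (nvar q)
  o-∧ˡ : ∀ {φ ψ} → OccFm q φ → OccFm q (φ ∧ᶠ ψ)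
  o-∧ʳ : ∀ {φ ψ} → OccFm q ψ → OccFm q (φ ∧ᶠ ψ)
  o-∨ˡ : ∀ {φ ψ} → OccFm q φ → OccFm q (φ ∨ᶠ ψ)
  o-∨ʳ : ∀ {φ ψ} → OccFm q ψ → OccFm q (φ ∨ᶠ ψ)
  o-□ : ∀ {φ} → OccFm q φ → OccFm q (□ᶠ φ)
  o-◇ : ∀ {φ} → OccFm q φ → OccFm q (◇ᶠ φ)

-- Nested sequents  φ₁,…,φₙ,[Γ₁],…,[Γₘ]

data Seq : Set where
  seq : List Fm → List Seq → Seq

-- Labels: finite sequences of naturals; root is 1, the i-th box (i ≥ 1)
-- directly inside σ is σ * i = σ ++ [ i ].
Label : Set
Label = List ℕ

rootL : Label
rootL = 1 ∷ []

_*_ : Label → ℕ → Label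
σ * i = σ ++ [ i ]

-- i-th element (1-based) of the list of boxes
ith : List Seq → ℕ → Maybe Seq
ith []       _             = nothing
ith (x ∷ xs) zero          = nothing
ith (x ∷ xs) (suc zero)    = just x
ith (x ∷ xs) (suc (suc k)) = ith xs (suc k)

data NodeAt : Seq → List ℕ → Seq → Set where
  here  : ∀ {Γ} → NodeAt Γ [] Γ
  there : ∀ {fs bs i is Δ Θ} → ith bs i ≡ just Δ → NodeAt Δ is Θ →
          NodeAt (seq fs bs) (i ∷ is) Θ

At : Seq → Label → Seq → Set
At Γ σ Δ = Σ[ path ∈ List ℕ ] (σ ≡ 1 ∷ path) × NodeAt Γ path Δ

InL : Seq → Label → Set
InL Γ σ = Σ[ Δ ∈ Seq ] At Γ σ Δ

formulasOf : Seq → List Fm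
formulasOf (seq fs _) = fs

_∶_∈ˢ_ : Label → Fm → Seq → Set
σ ∶ φ ∈ˢ Γ = Σ[ Δ ∈ Seq ] At Γ σ Δ × (φ ∈ formulasOf Δ)

OccSeq : ℕ → Seq → Set
OccSeq q Γ = Σ[ σ ∈ Label ] Σ[ φ ∈ Fm ] (σ ∶ φ ∈ˢ Γ) × OccFm q φ

record Model : Set where
  field
    size : ℕ
    R    : Fin size → Fin size → Bool
    V    : Fin size → ℕ → Bool

open Model public

World : Model → Set
World M = Fin (size M)

data Path (M : Model) : World M → World M → Set where
  stop : ∀ {w} → Path M w w
  step : ∀ {u v w} → R M u v ≡ true → Path M v w → Path M u w

record IsKModel (M : Model) : Set where
  field
    root         : World M
    root-no-pred : ∀ w → R M w root ≡ false
    reachable    : ∀ w → Path M root w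
    unique-pred  : ∀ u v w → R M u w ≡ true → R M v w ≡ true → u ≡ v
    irreflexive  : ∀ w → R M w w ≡ false
    intransitive : ∀ u v w → R M u v ≡ true → R M v w ≡ true → R M u w ≡ false

_,_⊨_ : (M : Model) → World M → Fm → Set
M , w ⊨ ⊥ᶠ = ⊥
M , w ⊨ ⊤ᶠ = ⊤
M , w ⊨ var p = V M w p ≡ true
M , w ⊨ nvar p = V M w p ≡ false
M , w ⊨ (φ ∧ᶠ ψ) = (M , w ⊨ φ) × (M , w ⊨ ψ)
M , w ⊨ (φ ∨ᶠ ψ) = (M , w ⊨ φ) ⊎ (M , w ⊨ ψ)
M , w ⊨ □ᶠ φ = ∀ v → R M w v ≡ true → M , v ⊨ φ
M , w ⊨ ◇ᶠ φ = Σ[ v ∈ World M ] R M w v ≡ true × (M , v ⊨ φ)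

-- Multiworld interpretations (represented as total maps Label → W;
-- only the values on 𝓛(Γ) matter).

IsInterp : Seq → (M : Model) → (Label → World M) → Set
IsInterp Γ M I = ∀ σ n → InL Γ σ → InL Γ (σ * n) → R M (I σ) (I (σ * n)) ≡ true

_,_⊨ˢ_ : (M : Model) → (Label → World M) → Seq → Set
M , I ⊨ˢ Γ = Σ[ σ ∈ Label ] Σ[ φ ∈ Fm ] (σ ∶ φ ∈ˢ Γ) × (M , I σ ⊨ φ)

data MF : Set where
  _∶_ : Label → Fm → MF
  _⋏_ _⋎_ : MF → MF → MF

_,_⊨ᵐ_ : (M : Model) → (Label → World M) → MF → Set
M , I ⊨ᵐ (σ ∶ φ) = M , I σ ⊨ φ
M , I ⊨ᵐ (A ⋏ B) = (M , I ⊨ᵐ A) × (M , I ⊨ᵐ B)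
M , I ⊨ᵐ (A ⋎ B) = (M , I ⊨ᵐ A) ⊎ (M , I ⊨ᵐ B)

data OccMF (q : ℕ) : MF → Set where
  o-lab : ∀ {σ φ} → OccFm q φ → OccMF q (σ ∶ φ)
  o-⋏ˡ : ∀ {A B} → OccMF q A → OccMF q (A ⋏ B)
  o-⋏ʳ : ∀ {A B} → OccMF q B → OccMF q (A ⋏ B)
  o-⋎ˡ : ∀ {A B} → OccMF q A → OccMF q (A ⋎ B)
  o-⋎ʳ : ∀ {A B} → OccMF q B → OccMF q (A ⋎ B)

data LabMF (σ : Label) : MF → Set where
  l-lab : ∀ {φ} → LabMF σ (σ ∶ φ)
  l-⋏ˡ : ∀ {A B} → LabMF σ A → LabMF σ (A ⋏ B)
  l-⋏ʳ : ∀ {A B} → LabMF σ B → LabMF σ (A ⋏ B)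
  l-⋎ˡ : ∀ {A B} → LabMF σ A → LabMF σ (A ⋎ B)
  l-⋎ʳ : ∀ {A B} → LabMF σ B → LabMF σ (A ⋎ B)

record IsBisimUpTo (p : ℕ) (M M' : Model) (Z : World M → World M' → Set) : Set where
  field
    nonempty : Σ[ w ∈ World M ] Σ[ w' ∈ World M' ] Z w w'
    atoms    : ∀ {w w'} → Z w w' → ∀ q → q ≢ p → V M w q ≡ V M' w' q
    forth    : ∀ {w w' v} → Z w w' → R M w v ≡ true →
               Σ[ v' ∈ World M' ] R M' w' v' ≡ true × Z v v'
    back     : ∀ {w w' v'} → Z w w' → R M' w' v' ≡ true →
               Σ[ v ∈ World M ] R M w v ≡ true × Z v v'

Bisim~ : ℕ → Seq → (M : Model) → (Label → World M) →
         (M' : Model) → (Label → World M') → Set₁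
Bisim~ p Γ M I M' I' =
  Σ[ Z ∈ (World M → World M' → Set) ]
    IsBisimUpTo p M M' Z × (∀ σ → InL Γ σ → Z (I σ) (I' σ))

-- BNUIP for a nested calculus whose sequents are nested sequents and
-- which is sound and complete w.r.t. the class of models 'IsL'.

BNUIP : (Model → Set) → Set₁
BNUIP IsL =
  ∀ (Γ : Seq) (p : ℕ) → Σ[ A ∈ MF ]
    ((∀ q → OccMF q A → OccSeq q Γ × q ≢ p) ×
     (∀ σ → LabMF σ A → InL Γ σ)) ×
    (∀ (M : Model) → IsL M → (I : Label → World M) → IsInterp Γ M I →
       M , I ⊨ᵐ A → M , I ⊨ˢ Γ) ×
    (∀ (M : Model) → IsL M → (I : Label → World M) → IsInterp Γ M I →
       ¬ (M , I ⊨ᵐ A) →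
       Σ[ M' ∈ Model ] IsL M' × Σ[ I' ∈ (Label → World M') ]
         IsInterp Γ M' I' × Bisim~ p Γ M' I' M I × ¬ (M' , I' ⊨ˢ Γ))

{-# OPTIONS --safe #-}
-- The interpolant of Γ is computed by recursion along Γ, with the modal depth of Γ as fuel:
-- each node is brought into conjunctive normal form, and each clause is interpolated by its
-- p-free literals, by interpolants for its modal part one level deeper, and by interpolants
-- for the boxes below the node, enlarged with the clause's ◇-formulas.  For (iii)′, if the interpolant fails under I, the
-- recursion picks at every node a failing clause and builds a finite tree, bisimilar up to p
-- to the worlds I σ, that refutes this clause (p gets the value falsifying the clause's
-- p-literal) and hence the whole node; where the fuel runs out, M is unravelled.  Read as a
-- K-model, this tree gives M′ and I′.
module Submission where

open import Defs
open import Data.Bool using (Bool; true; false)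
open import Data.Bool.Properties using () renaming (_≟_ to _≟ᵇ_)
open import Data.Empty using (⊥; ⊥-elim)
open import Data.Fin using (Fin; toℕ)
import Data.Fin.Properties as Finₚ
open import Data.List using (List; []; _∷_; _++_; [_]; map; filter; foldr; cartesianProductWith; allFin; length; lookup)
open import Data.List.Properties using (++-assoc; ++-identityʳ; ∷ʳ-injective; length-++; ≡-dec)
open import Data.List.Membership.Propositional using (_∈_; find; lose)
open import Data.List.Membership.Propositional.Properties
  using (∈-map⁺; ∈-map⁻; ∈-filter⁺; ∈-filter⁻; ∈-map∘filter⁺; ∈-map∘filter⁻; ∈-++⁺ˡ; ∈-++⁺ʳ; ∈-++⁻;
         ∈-cartesianProductWith⁺; ∈-cartesianProductWith⁻; ∈-lookup; ∈-allFin)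
import Data.List.Membership.DecPropositional as DecMembership
open import Data.List.Relation.Unary.Unique.Propositional using (Unique)
open import Data.List.Relation.Unary.AllPairs using ([]; _∷_)
import Data.List.Relation.Unary.Unique.Propositional.Properties as Uniqueₚ
open import Data.List.Relation.Unary.All as All using (All; []; _∷_)
import Data.List.Relation.Unary.All.Properties as Allₚ
open import Data.List.Relation.Unary.Any as Any using (Any; here; there)
import Data.List.Relation.Unary.Any.Properties as Anyₚ
open import Data.Maybe using (Maybe; just; nothing)
open import Data.Nat using (ℕ; zero; suc; _≤_; _<_; _+_; _⊔_; s≤s; z<s)
open import Data.Nat.Properties using (_≟_; <-irrefl; m<m+n; n≮0; _<?_; ≮⇒≥; <⇒≢; +-identityʳ; +-suc; +-cancelˡ-≡; ≤-pred; ≤-refl; ≤-trans; n≤1+n; m≤m⊔n; m≤n⊔m; m⊔n≤o⇒m≤o; m⊔n≤o⇒n≤o)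
open import Data.Product using (Σ-syntax; _×_; _,_; proj₁; proj₂)
open import Data.Sum using (_⊎_; inj₁; inj₂; [_,_]′)
open import Data.Unit using (⊤; tt)
open import Function using (_∘_; case_of_)
open import Relation.Nullary using (¬_; Dec; yes; no)
open import Relation.Nullary.Decidable using (_×-dec_; _⊎-dec_; _→-dec_; ¬?; map′)
open import Relation.Unary using (Decidable)
open import Relation.Binary.PropositionalEquality using (_≡_; _≢_; refl; sym; trans; cong; subst; subst₂)

private variable
  X : Set
  x : X
  xs : List X
  φ ψ χ : Fm
  n : ℕ
  σ : Label
  π : List ℕ
  fs gs : List Fm
  bs cs : List Seq
  Γ Δ : Seq

at : List X → ℕ → Maybe X
at []       _             = nothing
at (x ∷ xs) zero          = nothing
at (x ∷ xs) (suc zero)    = just x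
at (x ∷ xs) (suc (suc k)) = at xs (suc k)

ith≡at : ∀ bs i → ith bs i ≡ at bs i
ith≡at []       i             = refl
ith≡at (b ∷ bs) zero          = refl
ith≡at (b ∷ bs) (suc zero)    = refl
ith≡at (b ∷ bs) (suc (suc i)) = ith≡at bs (suc i)

at-zero : ∀ (xs : List X) → at xs 0 ≢ just x
at-zero []       ()
at-zero (_ ∷ _)  ()

at-suc : ∀ y (xs : List X) i → at xs i ≡ just x → at (y ∷ xs) (suc i) ≡ just x
at-suc y xs zero    e = ⊥-elim (at-zero xs e)
at-suc y xs (suc i) e = e

at-∈ : ∀ (xs : List X) i → at xs i ≡ just x → x ∈ xs
at-∈ (x ∷ xs) (suc zero)    refl = here refl
at-∈ (x ∷ xs) (suc (suc i)) e    = there (at-∈ xs (suc i) e)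

∈-at : x ∈ xs → Σ[ i ∈ ℕ ] at xs i ≡ just x
∈-at (here refl) = 1 , refl
∈-at {xs = y ∷ xs} (there m) with ∈-at m
... | i , e = suc i , at-suc y xs i e

ith-suc : ∀ b bs i → ith bs i ≡ just Δ → ith (b ∷ bs) (suc i) ≡ just Δ
ith-suc b bs i e rewrite ith≡at (b ∷ bs) (suc i) | ith≡at bs i = at-suc b bs i e

nodeAt-snoc : NodeAt Γ π (seq fs bs) → ∀ {i} → ith bs i ≡ just Δ → NodeAt Γ (π ++ [ i ]) Δ
nodeAt-snoc here         e = there e here
nodeAt-snoc (there e' n) e = there e' (nodeAt-snoc n e)

at-child : At Γ σ (seq fs bs) → ∀ {i} → ith bs i ≡ just Δ → At Γ (σ * i) Δ
at-child (π , refl , n) e = π ++ [ _ ] , refl , nodeAt-snoc n e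

data Somewhere (P : Label → List Fm → Set) : Label → List Fm → List Seq → Set where
  here  : P σ fs → Somewhere P σ fs bs
  below : ∀ {i} → ith bs i ≡ just (seq gs cs) → Somewhere P (σ * i) gs cs → Somewhere P σ fs bs

root-at : At Γ rootL Γ
root-at = [] , refl , here

somewhere-at : ∀ {P} → At Γ σ (seq fs bs) → Somewhere P σ fs bs →
               Σ[ τ ∈ Label ] Σ[ Δ ∈ Seq ] At Γ τ Δ × P τ (formulasOf Δ)
somewhere-at a (here h)    = _ , _ , a , h
somewhere-at a (below e s) = somewhere-at (at-child a e) s

somewhere-formula : ∀ {P : Label → Fm → Set} → At Γ σ (seq fs bs) →
                    Somewhere (λ τ → Any (P τ)) σ fs bs → Σ[ τ ∈ Label ] Σ[ φ ∈ Fm ] (τ ∶ φ ∈ˢ Γ) × P τ φ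
somewhere-formula a s with somewhere-at a s
... | τ , Δ , aτ , h with find h
...   | φ , m , Pφ = τ , φ , (Δ , aτ , m) , Pφ

data Flat : Set where
  fvar fnvar : ℕ → Flat
  fbox fdia  : Fm → Flat

⌜_⌝ : Flat → Fm
⌜ fvar q ⌝  = var q
⌜ fnvar q ⌝ = nvar q
⌜ fbox φ ⌝  = □ᶠ φ
⌜ fdia φ ⌝  = ◇ᶠ φ

Clause : Set
Clause = List Flat

private variable
  c : Clause

_⊗_ : List Clause → List Clause → List Clause
_⊗_ = cartesianProductWith _++_

-- a clause containing ⊤ is valid and is simply omitted
cnf : Fm → List Clause
cnf ⊥ᶠ       = [ [] ]
cnf ⊤ᶠ       = []
cnf (var q)  = [ [ fvar q ] ]
cnf (nvar q) = [ [ fnvar q ] ]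
cnf (φ ∧ᶠ ψ) = cnf φ ++ cnf ψ
cnf (φ ∨ᶠ ψ) = cnf φ ⊗ cnf ψ
cnf (□ᶠ φ)   = [ [ fbox φ ] ]
cnf (◇ᶠ φ)   = [ [ fdia φ ] ]

cnfˢ : List Fm → List Clause
cnfˢ []       = [ [] ]
cnfˢ (φ ∷ fs) = cnf φ ⊗ cnfˢ fs

boxes : Clause → List Fm
boxes []            = []
boxes (fvar _ ∷ c)  = boxes c
boxes (fnvar _ ∷ c) = boxes c
boxes (fbox φ ∷ c)  = φ ∷ boxes c
boxes (fdia _ ∷ c)  = boxes c

dias : Clause → List Fm
dias []            = []
dias (fvar _ ∷ c)  = dias c
dias (fnvar _ ∷ c) = dias c
dias (fbox _ ∷ c)  = dias c
dias (fdia φ ∷ c)  = φ ∷ dias c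

∈-boxes⁻ : ∀ c → φ ∈ boxes c → fbox φ ∈ c
∈-boxes⁻ (fvar _ ∷ c)  m         = there (∈-boxes⁻ c m)
∈-boxes⁻ (fnvar _ ∷ c) m         = there (∈-boxes⁻ c m)
∈-boxes⁻ (fbox _ ∷ c)  (here e)  = here (cong fbox e)
∈-boxes⁻ (fbox _ ∷ c)  (there m) = there (∈-boxes⁻ c m)
∈-boxes⁻ (fdia _ ∷ c)  m         = there (∈-boxes⁻ c m)

∈-boxes⁺ : fbox φ ∈ c → φ ∈ boxes c
∈-boxes⁺ (here refl) = here refl
∈-boxes⁺ {c = fvar _ ∷ _}  (there m) = ∈-boxes⁺ m
∈-boxes⁺ {c = fnvar _ ∷ _} (there m) = ∈-boxes⁺ m
∈-boxes⁺ {c = fbox _ ∷ _}  (there m) = there (∈-boxes⁺ m)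
∈-boxes⁺ {c = fdia _ ∷ _}  (there m) = ∈-boxes⁺ m

∈-dias⁻ : ∀ c → φ ∈ dias c → fdia φ ∈ c
∈-dias⁻ (fvar _ ∷ c)  m         = there (∈-dias⁻ c m)
∈-dias⁻ (fnvar _ ∷ c) m         = there (∈-dias⁻ c m)
∈-dias⁻ (fbox _ ∷ c)  m         = there (∈-dias⁻ c m)
∈-dias⁻ (fdia _ ∷ c)  (here e)  = here (cong fdia e)
∈-dias⁻ (fdia _ ∷ c)  (there m) = there (∈-dias⁻ c m)

∈-dias⁺ : fdia φ ∈ c → φ ∈ dias c
∈-dias⁺ (here refl) = here refl
∈-dias⁺ {c = fvar _ ∷ _}  (there m) = ∈-dias⁺ m
∈-dias⁺ {c = fnvar _ ∷ _} (there m) = ∈-dias⁺ m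
∈-dias⁺ {c = fbox _ ∷ _}  (there m) = ∈-dias⁺ m
∈-dias⁺ {c = fdia _ ∷ _}  (there m) = there (∈-dias⁺ m)

data _⊑_ : Fm → Fm → Set where
  ⊑-refl : φ ⊑ φ
  ⊑-∧ˡ   : φ ⊑ ψ → φ ⊑ (ψ ∧ᶠ χ)
  ⊑-∧ʳ   : φ ⊑ χ → φ ⊑ (ψ ∧ᶠ χ)
  ⊑-∨ˡ   : φ ⊑ ψ → φ ⊑ (ψ ∨ᶠ χ)
  ⊑-∨ʳ   : φ ⊑ χ → φ ⊑ (ψ ∨ᶠ χ)

∈-⊗⁻ : ∀ (cs ds : List Clause) {f e} → f ∈ e → e ∈ cs ⊗ ds →
       (Σ[ c ∈ Clause ] c ∈ cs × f ∈ c) ⊎ (Σ[ d ∈ Clause ] d ∈ ds × f ∈ d)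
∈-⊗⁻ cs ds fe m with ∈-cartesianProductWith⁻ _++_ cs ds m
... | c , d , mc , md , refl with ∈-++⁻ c fe
...   | inj₁ fc = inj₁ (c , mc , fc)
...   | inj₂ fd = inj₂ (d , md , fd)

cnf-⊑ : ∀ φ {f c} → c ∈ cnf φ → f ∈ c → ⌜ f ⌝ ⊑ φ
cnf-⊑ ⊥ᶠ       (here refl) ()
cnf-⊑ (var _)  (here refl) (here refl) = ⊑-refl
cnf-⊑ (nvar _) (here refl) (here refl) = ⊑-refl
cnf-⊑ (□ᶠ _)   (here refl) (here refl) = ⊑-refl
cnf-⊑ (◇ᶠ _)   (here refl) (here refl) = ⊑-refl
cnf-⊑ (φ ∧ᶠ ψ) m fc with ∈-++⁻ (cnf φ) m
... | inj₁ mφ = ⊑-∧ˡ (cnf-⊑ φ mφ fc)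
... | inj₂ mψ = ⊑-∧ʳ (cnf-⊑ ψ mψ fc)
cnf-⊑ (φ ∨ᶠ ψ) m fc with ∈-⊗⁻ (cnf φ) (cnf ψ) fc m
... | inj₁ (_ , mφ , f∈) = ⊑-∨ˡ (cnf-⊑ φ mφ f∈)
... | inj₂ (_ , mψ , f∈) = ⊑-∨ʳ (cnf-⊑ ψ mψ f∈)

cnfˢ-⊑ : ∀ fs {f c} → c ∈ cnfˢ fs → f ∈ c → Any (⌜ f ⌝ ⊑_) fs
cnfˢ-⊑ []       (here refl) ()
cnfˢ-⊑ (φ ∷ fs) m fc with ∈-⊗⁻ (cnf φ) (cnfˢ fs) fc m
... | inj₁ (_ , mφ , f∈) = here (cnf-⊑ φ mφ f∈)
... | inj₂ (_ , ms , f∈) = there (cnfˢ-⊑ fs ms f∈)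

⊑-occ : ∀ {q} → φ ⊑ ψ → OccFm q φ → OccFm q ψ
⊑-occ ⊑-refl   o = o
⊑-occ (⊑-∧ˡ s) o = o-∧ˡ (⊑-occ s o)
⊑-occ (⊑-∧ʳ s) o = o-∧ʳ (⊑-occ s o)
⊑-occ (⊑-∨ˡ s) o = o-∨ˡ (⊑-occ s o)
⊑-occ (⊑-∨ʳ s) o = o-∨ʳ (⊑-occ s o)

Bounded : ℕ → Fm → Set
Bounded n       (φ ∧ᶠ ψ) = Bounded n φ × Bounded n ψ
Bounded n       (φ ∨ᶠ ψ) = Bounded n φ × Bounded n ψ
Bounded zero    (□ᶠ φ)   = ⊥
Bounded (suc n) (□ᶠ φ)   = Bounded n φ
Bounded zero    (◇ᶠ φ)   = ⊥
Bounded (suc n) (◇ᶠ φ)   = Bounded n φ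
Bounded n       _        = ⊤

Boundedˢ : ℕ → List Seq → Set
Boundedˢ n []               = ⊤
Boundedˢ n (seq gs cs ∷ bs) = All (Bounded n) gs × Boundedˢ n cs × Boundedˢ n bs

⊑-bounded : φ ⊑ ψ → Bounded n ψ → Bounded n φ
⊑-bounded ⊑-refl   b       = b
⊑-bounded (⊑-∧ˡ s) (b , _) = ⊑-bounded s b
⊑-bounded (⊑-∧ʳ s) (_ , b) = ⊑-bounded s b
⊑-bounded (⊑-∨ˡ s) (b , _) = ⊑-bounded s b
⊑-bounded (⊑-∨ʳ s) (_ , b) = ⊑-bounded s b

bounded-mono : ∀ {m} φ → m ≤ n → Bounded m φ → Bounded n φ
bounded-mono ⊥ᶠ       _         _       = tt
bounded-mono ⊤ᶠ       _         _       = tt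
bounded-mono (var _)  _         _       = tt
bounded-mono (nvar _) _         _       = tt
bounded-mono (φ ∧ᶠ ψ) le        (b , c) = bounded-mono φ le b , bounded-mono ψ le c
bounded-mono (φ ∨ᶠ ψ) le        (b , c) = bounded-mono φ le b , bounded-mono ψ le c
bounded-mono (□ᶠ φ)   (s≤s le)  b       = bounded-mono φ le b
bounded-mono (◇ᶠ φ)   (s≤s le)  b       = bounded-mono φ le b

depth : Fm → ℕ
depth (φ ∧ᶠ ψ) = depth φ ⊔ depth ψ
depth (φ ∨ᶠ ψ) = depth φ ⊔ depth ψ
depth (□ᶠ φ)   = suc (depth φ)
depth (◇ᶠ φ)   = suc (depth φ)
depth _        = 0

bounded-depth : ∀ φ → depth φ ≤ n → Bounded n φ
bounded-depth ⊥ᶠ       _  = tt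
bounded-depth ⊤ᶠ       _  = tt
bounded-depth (var _)  _  = tt
bounded-depth (nvar _) _  = tt
bounded-depth (φ ∧ᶠ ψ) le = bounded-depth φ (m⊔n≤o⇒m≤o _ _ le) , bounded-depth ψ (m⊔n≤o⇒n≤o _ _ le)
bounded-depth (φ ∨ᶠ ψ) le = bounded-depth φ (m⊔n≤o⇒m≤o _ _ le) , bounded-depth ψ (m⊔n≤o⇒n≤o _ _ le)
bounded-depth (□ᶠ φ)   (s≤s le) = bounded-depth φ le
bounded-depth (◇ᶠ φ)   (s≤s le) = bounded-depth φ le

depthᶠ : List Fm → ℕ
depthᶠ = foldr (_⊔_ ∘ depth) 0

depthˢ : List Seq → ℕ
depthˢ []               = 0
depthˢ (seq gs cs ∷ bs) = depthᶠ gs ⊔ depthˢ cs ⊔ depthˢ bs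

bounded-depthᶠ : ∀ fs → depthᶠ fs ≤ n → All (Bounded n) fs
bounded-depthᶠ []       _  = []
bounded-depthᶠ (φ ∷ fs) le = bounded-depth φ (m⊔n≤o⇒m≤o _ _ le) ∷ bounded-depthᶠ fs (m⊔n≤o⇒n≤o _ _ le)

bounded-depthˢ : ∀ bs → depthˢ bs ≤ n → Boundedˢ n bs
bounded-depthˢ []               _  = tt
bounded-depthˢ (seq gs cs ∷ bs) le =
  bounded-depthᶠ gs (m⊔n≤o⇒m≤o _ _ (m⊔n≤o⇒m≤o _ (depthˢ bs) le)) ,
  bounded-depthˢ cs (m⊔n≤o⇒n≤o (depthᶠ gs) _ (m⊔n≤o⇒m≤o _ (depthˢ bs) le)) ,
  bounded-depthˢ bs (m⊔n≤o⇒n≤o (depthᶠ gs ⊔ depthˢ cs) _ le)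

⋁ : List Fm → Fm
⋁ = foldr _∨ᶠ_ ⊥ᶠ

unlabel : MF → Fm
unlabel (σ ∶ φ) = φ
unlabel (A ⋏ B) = unlabel A ∧ᶠ unlabel B
unlabel (A ⋎ B) = unlabel A ∨ᶠ unlabel B

unlabel-occ : ∀ {q} A → OccFm q (unlabel A) → OccMF q A
unlabel-occ (σ ∶ φ) o        = o-lab o
unlabel-occ (A ⋏ B) (o-∧ˡ o) = o-⋏ˡ (unlabel-occ A o)
unlabel-occ (A ⋏ B) (o-∧ʳ o) = o-⋏ʳ (unlabel-occ B o)
unlabel-occ (A ⋎ B) (o-∨ˡ o) = o-⋎ˡ (unlabel-occ A o)
unlabel-occ (A ⋎ B) (o-∨ʳ o) = o-⋎ʳ (unlabel-occ B o)

module Semantics (M : Model) where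

  dec⊨ : ∀ w φ → Dec (M , w ⊨ φ)
  dec⊨ w ⊥ᶠ       = no λ ()
  dec⊨ w ⊤ᶠ       = yes tt
  dec⊨ w (var q)  = V M w q ≟ᵇ true
  dec⊨ w (nvar q) = V M w q ≟ᵇ false
  dec⊨ w (φ ∧ᶠ ψ) = dec⊨ w φ ×-dec dec⊨ w ψ
  dec⊨ w (φ ∨ᶠ ψ) = dec⊨ w φ ⊎-dec dec⊨ w ψ
  dec⊨ w (□ᶠ φ)   = Finₚ.all? λ v → (R M w v ≟ᵇ true) →-dec dec⊨ v φ
  dec⊨ w (◇ᶠ φ)   = Finₚ.any? λ v → (R M w v ≟ᵇ true) ×-dec dec⊨ v φ

  dec⊨ᵐ : ∀ I A → Dec (M , I ⊨ᵐ A)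
  dec⊨ᵐ I (σ ∶ φ) = dec⊨ (I σ) φ
  dec⊨ᵐ I (A ⋏ B) = dec⊨ᵐ I A ×-dec dec⊨ᵐ I B
  dec⊨ᵐ I (A ⋎ B) = dec⊨ᵐ I A ⊎-dec dec⊨ᵐ I B

  ¬□⇒◇¬ : ∀ w φ → ¬ (M , w ⊨ □ᶠ φ) → Σ[ v ∈ World M ] R M w v ≡ true × ¬ (M , v ⊨ φ)
  ¬□⇒◇¬ w φ ¬□ with Finₚ.¬∀⟶∃¬ (size M) _ (λ v → (R M w v ≟ᵇ true) →-dec dec⊨ v φ) ¬□
  ... | v , ¬h with R M w v in r
  ...   | true  = v , r , λ h → ¬h λ _ → h
  ...   | false = ⊥-elim (¬h λ ())

  ⋁⁻ : ∀ {w} φs → M , w ⊨ ⋁ φs → Any (M , w ⊨_) φs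
  ⋁⁻ (φ ∷ φs) (inj₁ h) = here h
  ⋁⁻ (φ ∷ φs) (inj₂ h) = there (⋁⁻ φs h)

  ⋁⁺ : ∀ {w φs} → Any (M , w ⊨_) φs → M , w ⊨ ⋁ φs
  ⋁⁺ (here h)  = inj₁ h
  ⋁⁺ (there a) = inj₂ (⋁⁺ a)

  unlabel⁻ : ∀ {v} A → M , v ⊨ unlabel A → M , (λ _ → v) ⊨ᵐ A
  unlabel⁻ (σ ∶ φ) h              = h
  unlabel⁻ (A ⋏ B) (a , b)        = unlabel⁻ A a , unlabel⁻ B b
  unlabel⁻ (A ⋎ B) (inj₁ a)       = inj₁ (unlabel⁻ A a)
  unlabel⁻ (A ⋎ B) (inj₂ b)       = inj₂ (unlabel⁻ B b)

  unlabel⁺ : ∀ {v} A → M , (λ _ → v) ⊨ᵐ A → M , v ⊨ unlabel A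
  unlabel⁺ (σ ∶ φ) h              = h
  unlabel⁺ (A ⋏ B) (a , b)        = unlabel⁺ A a , unlabel⁺ B b
  unlabel⁺ (A ⋎ B) (inj₁ a)       = inj₁ (unlabel⁺ A a)
  unlabel⁺ (A ⋎ B) (inj₂ b)       = inj₂ (unlabel⁺ B b)

  Refuted : World M → Clause → Set
  Refuted w = All (λ f → ¬ (M , w ⊨ ⌜ f ⌝))

  cnf-refuted : ∀ w φ → ¬ (M , w ⊨ φ) → Σ[ c ∈ Clause ] c ∈ cnf φ × Refuted w c
  cnf-refuted w ⊥ᶠ       ¬h = _ , here refl , []
  cnf-refuted w ⊤ᶠ       ¬h = ⊥-elim (¬h tt)
  cnf-refuted w (var q)  ¬h = _ , here refl , ¬h ∷ []
  cnf-refuted w (nvar q) ¬h = _ , here refl , ¬h ∷ []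
  cnf-refuted w (□ᶠ φ)   ¬h = _ , here refl , ¬h ∷ []
  cnf-refuted w (◇ᶠ φ)   ¬h = _ , here refl , ¬h ∷ []
  cnf-refuted w (φ ∧ᶠ ψ) ¬h with dec⊨ w φ
  ... | yes a with cnf-refuted w ψ (λ b → ¬h (a , b))
  ...   | c , m , r = c , ∈-++⁺ʳ (cnf φ) m , r
  cnf-refuted w (φ ∧ᶠ ψ) ¬h | no ¬a with cnf-refuted w φ ¬a
  ...   | c , m , r = c , ∈-++⁺ˡ m , r
  cnf-refuted w (φ ∨ᶠ ψ) ¬h with cnf-refuted w φ (¬h ∘ inj₁) | cnf-refuted w ψ (¬h ∘ inj₂)
  ... | c , m , r | d , m' , r' = c ++ d , ∈-cartesianProductWith⁺ _++_ m m' , Allₚ.++⁺ r r'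

  cnfˢ-refuted : ∀ w fs → All (λ φ → ¬ (M , w ⊨ φ)) fs → Σ[ c ∈ Clause ] c ∈ cnfˢ fs × Refuted w c
  cnfˢ-refuted w []       []         = [] , here refl , []
  cnfˢ-refuted w (φ ∷ fs) (¬h ∷ ¬hs) with cnf-refuted w φ ¬h | cnfˢ-refuted w fs ¬hs
  ... | c , m , r | d , m' , r' = c ++ d , ∈-cartesianProductWith⁺ _++_ m m' , Allₚ.++⁺ r r'

  -- I sends the boxes bs, which sit below σ at labels f 1, f 2, …, to successors, hereditarily
  Fits : (Label → World M) → (ℕ → Label) → Label → List Seq → Set
  Fits I f σ []               = ⊤
  Fits I f σ (seq gs cs ∷ bs) = R M (I σ) (I (f 1)) ≡ true × Fits I (f 1 *_) (f 1) cs × Fits I (f ∘ suc) σ bs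

  ChildrenIn : Seq → (ℕ → Label) → Label → List Seq → Set
  ChildrenIn Γ f σ bs = InL Γ σ × (∀ {i Δ} → ith bs i ≡ just Δ → Σ[ k ∈ ℕ ] f i ≡ σ * k × At Γ (f i) Δ)

  fits : ∀ {I} → IsInterp Γ M I → ∀ f σ bs → ChildrenIn Γ f σ bs → Fits I f σ bs
  fits ii f σ []               _         = tt
  fits {Γ} {I} ii f σ (seq gs cs ∷ bs) (inσ , ch) with ch {1} refl
  ... | k , e , a =
    subst (λ τ → R M (I σ) (I τ) ≡ true) (sym e) (ii σ k inσ (_ , subst (λ τ → At Γ τ _) e a)) ,
    fits ii (f 1 *_) (f 1) cs ((_ , a) , λ e' → _ , refl , at-child a e') ,
    fits ii (f ∘ suc) σ bs (inσ , λ {i} e' → ch (ith-suc _ bs i e'))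

  fits-root : ∀ {I} → IsInterp (seq fs bs) M I → Fits I (rootL *_) rootL bs
  fits-root {bs = bs} ii = fits ii _ rootL bs ((_ , root-at) , λ e → _ , refl , at-child root-at e)

module Interpolant (p : ℕ) where

  PFree : Flat → Set
  PFree (fvar q)  = q ≢ p
  PFree (fnvar q) = q ≢ p
  PFree (fbox _)  = ⊥
  PFree (fdia _)  = ⊥

  pfree? : Decidable PFree
  pfree? (fvar q)  = ¬? (q ≟ p)
  pfree? (fnvar q) = ¬? (q ≟ p)
  pfree? (fbox _)  = no λ ()
  pfree? (fdia _)  = no λ ()

  fvar-p? : ∀ f → Dec (fvar p ≡ f)
  fvar-p? (fvar q)  = map′ (cong fvar) (λ { refl → refl }) (p ≟ q)
  fvar-p? (fnvar _) = no λ ()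
  fvar-p? (fbox _)  = no λ ()
  fvar-p? (fdia _)  = no λ ()

  fnvar-p? : ∀ f → Dec (fnvar p ≡ f)
  fnvar-p? (fvar _)  = no λ ()
  fnvar-p? (fnvar q) = map′ (cong fnvar) (λ { refl → refl }) (p ≟ q)
  fnvar-p? (fbox _)  = no λ ()
  fnvar-p? (fdia _)  = no λ ()

  Clash : Clause → Set
  Clash c = fvar p ∈ c × fnvar p ∈ c

  clash? : ∀ c → Dec (Clash c)
  clash? c = Any.any? fvar-p? c ×-dec Any.any? fnvar-p? c

  literalsF : Clause → Fm
  literalsF c = ⋁ (map ⌜_⌝ (filter pfree? c))

  clashF : Clause → Fm
  clashF c with clash? c
  ... | yes _ = ⊤ᶠ
  ... | no _  = ⊥ᶠ

  -- Read off the rules of NK: the propositional rules split a node into clauses, id_P closes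
  -- a clause containing p and p̄, the □- and k-rules reduce its modal part to a sequent one
  -- modal level lower (successorsF), and the k-rule pushes its ◇-formulas into every box
  -- below (boxesI).  The fuel n bounds the modal depth.
  mutual
    nodeI : ℕ → Label → List Fm → List Seq → MF
    nodeI n σ fs bs = clausesI n σ (cnfˢ fs) bs

    clausesI : ℕ → Label → List Clause → List Seq → MF
    clausesI n σ []       bs = σ ∶ ⊤ᶠ
    clausesI n σ (c ∷ cs) bs = clauseI n σ c bs ⋏ clausesI n σ cs bs

    clauseI : ℕ → Label → Clause → List Seq → MF
    clauseI n σ c bs = (σ ∶ ((literalsF c ∨ᶠ clashF c) ∨ᶠ modalF n c)) ⋎ boxesI n (σ *_) σ (dias c) bs

    modalF : ℕ → Clause → Fm
    modalF zero    c = ⊥ᶠ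
    modalF (suc n) c = successorsF n (dias c) (boxes c)

    successorsF : ℕ → List Fm → List Fm → Fm
    successorsF n Ds []       = ◇ᶠ (unlabel (nodeI n rootL Ds []))
    successorsF n Ds (φ ∷ φs) = □ᶠ (unlabel (nodeI n rootL (φ ∷ Ds) [])) ∨ᶠ successorsF n Ds φs

    boxesI : ℕ → (ℕ → Label) → Label → List Fm → List Seq → MF
    boxesI n f σ Ds []               = σ ∶ ⊥ᶠ
    boxesI n f σ Ds (seq gs cs ∷ bs) = nodeI n (f 1) (gs ++ Ds) cs ⋎ boxesI n (f ∘ suc) σ Ds bs

module Soundness (p : ℕ) (M : Model) where
  open Interpolant p
  open Semantics M

  Sat : (Label → World M) → Label → List Fm → List Seq → Set
  Sat I = Somewhere (λ σ → Any (M , I σ ⊨_))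

  clausesI-∈ : ∀ {n I σ c cs bs} → M , I ⊨ᵐ clausesI n σ cs bs → c ∈ cs → M , I ⊨ᵐ clauseI n σ c bs
  clausesI-∈ (h , _) (here refl) = h
  clausesI-∈ (_ , h) (there m)   = clausesI-∈ h m

  literalsF-sound : ∀ {w} c → Refuted w c → ¬ (M , w ⊨ literalsF c)
  literalsF-sound c r h with find (⋁⁻ (map ⌜_⌝ (filter pfree? c)) h)
  ... | φ , m , hφ with ∈-map∘filter⁻ ⌜_⌝ pfree? m
  ...   | f , f∈ , refl , _ = All.lookup r f∈ hφ

  clashF-sound : ∀ {w} c → Refuted w c → ¬ (M , w ⊨ clashF c)
  clashF-sound {w} c r h with clash? c
  ... | yes (m , m̄) with V M w p in e
  ...   | true  = All.lookup r m e
  ...   | false = All.lookup r m̄ e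
  clashF-sound c r h | no _ = h

  mutual
    nodeI-sound : ∀ n {I σ} fs bs → Fits I (σ *_) σ bs → M , I ⊨ᵐ nodeI n σ fs bs → Sat I σ fs bs
    nodeI-sound n {I} {σ} fs bs F h with Any.any? (dec⊨ (I σ)) fs
    ... | yes a  = here a
    ... | no ¬a with cnfˢ-refuted (I σ) fs (Allₚ.¬Any⇒All¬ fs ¬a)
    ...   | c , m , r = clauseI-sound n c bs F r (clausesI-∈ h m)

    clauseI-sound : ∀ n {I σ fs} c bs → Fits I (σ *_) σ bs → Refuted (I σ) c →
                    M , I ⊨ᵐ clauseI n σ c bs → Sat I σ fs bs
    clauseI-sound n c bs F r (inj₁ (inj₁ (inj₁ h))) = ⊥-elim (literalsF-sound c r h)
    clauseI-sound n c bs F r (inj₁ (inj₁ (inj₂ h))) = ⊥-elim (clashF-sound c r h)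
    clauseI-sound (suc n) c bs F r (inj₁ (inj₂ h)) =
      ⊥-elim (successorsF-sound n (dias c) (boxes c)
        (All.tabulate (All.lookup r ∘ ∈-boxes⁻ c)) (All.tabulate (All.lookup r ∘ ∈-dias⁻ c)) h)
    clauseI-sound n c bs F r (inj₂ h) with boxesI-sound n (dias c) bs F (All.tabulate (All.lookup r ∘ ∈-dias⁻ c)) h
    ... | _ , _ , _ , e , s = below e s

    leaf-sound : ∀ n {v} Ds → M , v ⊨ unlabel (nodeI n rootL Ds []) → Any (M , v ⊨_) Ds
    leaf-sound n Ds h with nodeI-sound n Ds [] tt (unlabel⁻ (nodeI n rootL Ds []) h)
    ... | here a = a

    successorsF-sound : ∀ n {w} Ds φs → All (λ φ → ¬ (M , w ⊨ □ᶠ φ)) φs → All (λ D → ¬ (M , w ⊨ ◇ᶠ D)) Ds →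
                        ¬ (M , w ⊨ successorsF n Ds φs)
    successorsF-sound n Ds [] _ ¬◇ (v , r , h) with find (leaf-sound n Ds h)
    ... | D , m , hD = All.lookup ¬◇ m (v , r , hD)
    successorsF-sound n Ds (φ ∷ φs) (¬□ ∷ ¬□s) ¬◇ (inj₂ h) = successorsF-sound n Ds φs ¬□s ¬◇ h
    successorsF-sound n Ds (φ ∷ φs) (¬□ ∷ _)   ¬◇ (inj₁ h) = ¬□ λ v r → at-φ v r (leaf-sound n (φ ∷ Ds) (h v r))
      where
      at-φ : ∀ v → R M _ v ≡ true → Any (M , v ⊨_) (φ ∷ Ds) → M , v ⊨ φ
      at-φ v r (here hφ) = hφ
      at-φ v r (there a) with find a
      ... | D , m , hD = ⊥-elim (All.lookup ¬◇ m (v , r , hD))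

    boxesI-sound : ∀ n {I f σ} Ds bs → Fits I f σ bs → All (λ D → ¬ (M , I σ ⊨ ◇ᶠ D)) Ds →
                   M , I ⊨ᵐ boxesI n f σ Ds bs →
                   Σ[ i ∈ ℕ ] Σ[ gs ∈ List Fm ] Σ[ cs ∈ List Seq ] ith bs i ≡ just (seq gs cs) × Sat I (f i) gs cs
    boxesI-sound n Ds (seq gs cs ∷ bs) (_ , _ , F) ¬◇ (inj₂ h) with boxesI-sound n Ds bs F ¬◇ h
    ... | i , _ , _ , e , s = suc i , _ , _ , ith-suc _ bs i e , s
    boxesI-sound n {I} {f} Ds (seq gs cs ∷ bs) (r , F , _) ¬◇ (inj₁ h) =
      1 , gs , cs , refl , drop-inherited (nodeI-sound n (gs ++ Ds) cs F h)
      where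
      drop-inherited : Sat I (f 1) (gs ++ Ds) cs → Sat I (f 1) gs cs
      drop-inherited (below e s) = below e s
      drop-inherited (here a) with Anyₚ.++⁻ gs a
      ... | inj₁ a' = here a'
      ... | inj₂ a' with find a'
      ...   | D , m , hD = ⊥-elim (All.lookup ¬◇ m (I (f 1) , r , hD))

  nodeI-sound-root : ∀ n {I} fs bs → IsInterp (seq fs bs) M I → M , I ⊨ᵐ nodeI n rootL fs bs → M , I ⊨ˢ seq fs bs
  nodeI-sound-root n fs bs ii h = somewhere-formula root-at (nodeI-sound n fs bs (fits-root ii) h)

module Vocabulary (p : ℕ) where
  open Interpolant p

  OccIn : ℕ → Label → List Fm → List Seq → Set
  OccIn q = Somewhere (λ _ → Any (OccFm q))

  Located : Label → Label → List Fm → List Seq → Set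
  Located τ = Somewhere (λ σ _ → τ ≡ σ)

  ⋁-occ : ∀ {q} φs → OccFm q (⋁ φs) → Any (OccFm q) φs
  ⋁-occ (φ ∷ φs) (o-∨ˡ o) = here o
  ⋁-occ (φ ∷ φs) (o-∨ʳ o) = there (⋁-occ φs o)

  pfree-occ : ∀ {q} f → PFree f → OccFm q ⌜ f ⌝ → q ≢ p
  pfree-occ (fvar _)  q≢p o-var  = q≢p
  pfree-occ (fnvar _) q≢p o-nvar = q≢p

  clause-occ : ∀ {q f c} fs → c ∈ cnfˢ fs → f ∈ c → OccFm q ⌜ f ⌝ → Any (OccFm q) fs
  clause-occ fs m f∈ o = Any.map (λ s → ⊑-occ s o) (cnfˢ-⊑ fs m f∈)

  literalsF-occ : ∀ {q} c → OccFm q (literalsF c) → q ≢ p × Σ[ f ∈ Flat ] f ∈ c × OccFm q ⌜ f ⌝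
  literalsF-occ c o with find (⋁-occ (map ⌜_⌝ (filter pfree? c)) o)
  ... | _ , m , o' with ∈-map∘filter⁻ ⌜_⌝ pfree? m
  ...   | f , f∈ , refl , free = pfree-occ f free o' , f , f∈ , o'

  clashF-occ : ∀ {q} c → ¬ OccFm q (clashF c)
  clashF-occ c o with clash? c
  clashF-occ c () | yes _
  clashF-occ c () | no _

  mutual
    nodeI-occ : ∀ {q} n σ fs bs → OccMF q (nodeI n σ fs bs) → q ≢ p × OccIn q σ fs bs
    nodeI-occ n σ fs bs = clausesI-occ n σ fs (cnfˢ fs) bs (λ m → m)

    clausesI-occ : ∀ {q} n σ fs cs bs → (∀ {c} → c ∈ cs → c ∈ cnfˢ fs) →
                   OccMF q (clausesI n σ cs bs) → q ≢ p × OccIn q σ fs bs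
    clausesI-occ n σ fs []       bs sub (o-lab ())
    clausesI-occ n σ fs (c ∷ cs) bs sub (o-⋏ˡ o) = clauseI-occ n σ fs c bs (sub (here refl)) o
    clausesI-occ n σ fs (c ∷ cs) bs sub (o-⋏ʳ o) = clausesI-occ n σ fs cs bs (sub ∘ there) o

    clauseI-occ : ∀ {q} n σ fs c bs → c ∈ cnfˢ fs → OccMF q (clauseI n σ c bs) → q ≢ p × OccIn q σ fs bs
    clauseI-occ n σ fs c bs m (o-⋎ˡ (o-lab (o-∨ˡ (o-∨ˡ o)))) with literalsF-occ c o
    ... | q≢p , f , f∈ , o' = q≢p , here (clause-occ fs m f∈ o')
    clauseI-occ n σ fs c bs m (o-⋎ˡ (o-lab (o-∨ˡ (o-∨ʳ o)))) = ⊥-elim (clashF-occ c o)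
    clauseI-occ (suc n) σ fs c bs m (o-⋎ˡ (o-lab (o-∨ʳ o))) with successorsF-occ n (dias c) (boxes c) o
    ... | q≢p , inj₁ a with find a
    ...   | φ , φ∈ , oφ = q≢p , here (clause-occ fs m (∈-boxes⁻ c φ∈) (o-□ oφ))
    clauseI-occ (suc n) σ fs c bs m (o-⋎ˡ (o-lab (o-∨ʳ o))) | q≢p , inj₂ a with find a
    ...   | D , D∈ , oD = q≢p , here (clause-occ fs m (∈-dias⁻ c D∈) (o-◇ oD))
    clauseI-occ n σ fs c bs m (o-⋎ʳ o) with boxesI-occ n (σ *_) σ (dias c) bs o
    ... | q≢p , inj₂ (_ , _ , e , o') = q≢p , below e o'
    ... | q≢p , inj₁ a with find a
    ...   | D , D∈ , oD = q≢p , here (clause-occ fs m (∈-dias⁻ c D∈) (o-◇ oD))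

    leaf-occ : ∀ {q} n Ds → OccFm q (unlabel (nodeI n rootL Ds [])) → q ≢ p × Any (OccFm q) Ds
    leaf-occ n Ds o with nodeI-occ n rootL Ds [] (unlabel-occ (nodeI n rootL Ds []) o)
    ... | q≢p , here a = q≢p , a

    successorsF-occ : ∀ {q} n Ds φs → OccFm q (successorsF n Ds φs) →
                      q ≢ p × (Any (OccFm q) φs ⊎ Any (OccFm q) Ds)
    successorsF-occ n Ds [] (o-◇ o) with leaf-occ n Ds o
    ... | q≢p , a = q≢p , inj₂ a
    successorsF-occ n Ds (φ ∷ φs) (o-∨ˡ (o-□ o)) with leaf-occ n (φ ∷ Ds) o
    ... | q≢p , here oφ = q≢p , inj₁ (here oφ)
    ... | q≢p , there a = q≢p , inj₂ a
    successorsF-occ n Ds (φ ∷ φs) (o-∨ʳ o) with successorsF-occ n Ds φs o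
    ... | q≢p , inj₁ a = q≢p , inj₁ (there a)
    ... | q≢p , inj₂ a = q≢p , inj₂ a

    boxesI-occ : ∀ {q} n f σ Ds bs → OccMF q (boxesI n f σ Ds bs) →
                 q ≢ p × (Any (OccFm q) Ds ⊎ Σ[ i ∈ ℕ ] Σ[ (gs , cs) ∈ List Fm × List Seq ]
                                               ith bs i ≡ just (seq gs cs) × OccIn q (f i) gs cs)
    boxesI-occ n f σ Ds [] (o-lab ())
    boxesI-occ n f σ Ds (seq gs cs ∷ bs) (o-⋎ˡ o) with nodeI-occ n (f 1) (gs ++ Ds) cs o
    ... | q≢p , below e o' = q≢p , inj₂ (1 , _ , refl , below e o')
    ... | q≢p , here a with Anyₚ.++⁻ gs a
    ...   | inj₁ a' = q≢p , inj₂ (1 , _ , refl , here a')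
    ...   | inj₂ a' = q≢p , inj₁ a'
    boxesI-occ n f σ Ds (seq gs cs ∷ bs) (o-⋎ʳ o) with boxesI-occ n (f ∘ suc) σ Ds bs o
    ... | q≢p , inj₁ a                = q≢p , inj₁ a
    ... | q≢p , inj₂ (i , _ , e , o') = q≢p , inj₂ (suc i , _ , ith-suc _ bs i e , o')

  mutual
    nodeI-lab : ∀ {τ} n σ fs bs → LabMF τ (nodeI n σ fs bs) → Located τ σ fs bs
    nodeI-lab n σ fs bs = clausesI-lab n σ (cnfˢ fs) bs

    clausesI-lab : ∀ {τ fs} n σ cs bs → LabMF τ (clausesI n σ cs bs) → Located τ σ fs bs
    clausesI-lab n σ []       bs l-lab    = here refl
    clausesI-lab n σ (c ∷ cs) bs (l-⋏ˡ l) = clauseI-lab n σ c bs l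
    clausesI-lab n σ (c ∷ cs) bs (l-⋏ʳ l) = clausesI-lab n σ cs bs l

    clauseI-lab : ∀ {τ fs} n σ c bs → LabMF τ (clauseI n σ c bs) → Located τ σ fs bs
    clauseI-lab n σ c bs (l-⋎ˡ l-lab) = here refl
    clauseI-lab n σ c bs (l-⋎ʳ l) with boxesI-lab n (σ *_) σ (dias c) bs l
    ... | inj₁ e               = here e
    ... | inj₂ (_ , _ , e , l') = below e l'

    boxesI-lab : ∀ {τ} n f σ Ds bs → LabMF τ (boxesI n f σ Ds bs) →
                 τ ≡ σ ⊎ Σ[ i ∈ ℕ ] Σ[ (gs , cs) ∈ List Fm × List Seq ]
                           ith bs i ≡ just (seq gs cs) × Located τ (f i) gs cs
    boxesI-lab n f σ Ds [] l-lab = inj₁ refl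
    boxesI-lab n f σ Ds (seq gs cs ∷ bs) (l-⋎ˡ l) with nodeI-lab n (f 1) (gs ++ Ds) cs l
    ... | here e     = inj₂ (1 , _ , refl , here e)
    ... | below e l' = inj₂ (1 , _ , refl , below e l')
    boxesI-lab n f σ Ds (seq gs cs ∷ bs) (l-⋎ʳ l) with boxesI-lab n (f ∘ suc) σ Ds bs l
    ... | inj₁ e                = inj₁ e
    ... | inj₂ (i , _ , e , l') = inj₂ (suc i , _ , ith-suc _ bs i e , l')

data Tree : Set where
  node : (ℕ → Bool) → List Tree → Tree

valuation : Tree → ℕ → Bool
valuation (node v _) = v

children : Tree → List Tree
children (node _ ts) = ts

infix 4 _⊨ᵗ_

_⊨ᵗ_ : Tree → Fm → Set
t ⊨ᵗ ⊥ᶠ       = ⊥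
t ⊨ᵗ ⊤ᶠ       = ⊤
t ⊨ᵗ var q    = valuation t q ≡ true
t ⊨ᵗ nvar q   = valuation t q ≡ false
t ⊨ᵗ (φ ∧ᶠ ψ) = (t ⊨ᵗ φ) × (t ⊨ᵗ ψ)
t ⊨ᵗ (φ ∨ᶠ ψ) = (t ⊨ᵗ φ) ⊎ (t ⊨ᵗ ψ)
t ⊨ᵗ □ᶠ φ     = All (_⊨ᵗ φ) (children t)
t ⊨ᵗ ◇ᶠ φ     = Any (_⊨ᵗ φ) (children t)

Falsifiedᵗ : List Fm → Tree → Set
Falsifiedᵗ fs t = All (λ φ → ¬ t ⊨ᵗ φ) fs

Refutedᵗ : Tree → Clause → Set
Refutedᵗ t = All (λ f → ¬ t ⊨ᵗ ⌜ f ⌝)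

refutedᵗ-cnf : ∀ {t c} φ → c ∈ cnf φ → Refutedᵗ t c → ¬ t ⊨ᵗ φ
refutedᵗ-cnf ⊥ᶠ       (here refl) _        ()
refutedᵗ-cnf (var _)  (here refl) (r ∷ []) = r
refutedᵗ-cnf (nvar _) (here refl) (r ∷ []) = r
refutedᵗ-cnf (□ᶠ _)   (here refl) (r ∷ []) = r
refutedᵗ-cnf (◇ᶠ _)   (here refl) (r ∷ []) = r
refutedᵗ-cnf (φ ∧ᶠ ψ) m r (hφ , hψ) with ∈-++⁻ (cnf φ) m
... | inj₁ mφ = refutedᵗ-cnf φ mφ r hφ
... | inj₂ mψ = refutedᵗ-cnf ψ mψ r hψ
refutedᵗ-cnf (φ ∨ᶠ ψ) m r h with ∈-cartesianProductWith⁻ _++_ (cnf φ) (cnf ψ) m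
... | c , _ , mc , md , refl with Allₚ.++⁻ c r
...   | rc , rd = [ refutedᵗ-cnf φ mc rc , refutedᵗ-cnf ψ md rd ]′ h

refutedᵗ-cnfˢ : ∀ {t c} fs → c ∈ cnfˢ fs → Refutedᵗ t c → Falsifiedᵗ fs t
refutedᵗ-cnfˢ []       _ _ = []
refutedᵗ-cnfˢ (φ ∷ fs) m r with ∈-cartesianProductWith⁻ _++_ (cnf φ) (cnfˢ fs) m
... | c , _ , mc , md , refl with Allₚ.++⁻ c r
...   | rc , rd = refutedᵗ-cnf φ mc rc ∷ refutedᵗ-cnfˢ fs md rd

pathLength : ∀ {M u w} → Path M u w → ℕ
pathLength stop       = 0
pathLength (step _ w) = suc (pathLength w)

module KModel (M : Model) (K : IsKModel M) where
  open IsKModel K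

  data Depth : ℕ → World M → Set where
    root-depth : Depth 0 root
    step-depth : ∀ {d v w} → Depth d v → R M v w ≡ true → Depth (suc d) w

  depth-unique : ∀ {a b w} → Depth a w → Depth b w → a ≡ b
  depth-unique root-depth root-depth = refl
  depth-unique root-depth (step-depth {v = v} _ r) with () ← trans (sym r) (root-no-pred v)
  depth-unique (step-depth {v = v} _ r) root-depth with () ← trans (sym r) (root-no-pred v)
  depth-unique (step-depth {v = v} d r) (step-depth {v = v'} d' r') with refl ← unique-pred v v' _ r r' =
    cong suc (depth-unique d d')

  depth-path : ∀ {d u w} → Depth d u → Path M u w → Σ[ e ∈ ℕ ] Depth e w
  depth-path d stop         = _ , d
  depth-path d (step r pth) = depth-path (step-depth d r) pth

  visit : ∀ {u w} (pth : Path M u w) → Fin (suc (pathLength pth)) → World M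
  visit {u} pth          Fin.zero    = u
  visit     (step _ pth) (Fin.suc k) = visit pth k

  visit-depth : ∀ {d u w} → Depth d u → (pth : Path M u w) → ∀ k → Depth (d + toℕ k) (visit pth k)
  visit-depth {d} dp _            Fin.zero    = subst (λ e → Depth e _) (sym (+-identityʳ d)) dp
  visit-depth {d} dp (step r pth) (Fin.suc k) =
    subst (λ e → Depth e (visit pth k)) (sym (+-suc d (toℕ k))) (visit-depth (step-depth dp r) pth k)

  -- a path visits pairwise distinct worlds, since their depths increase
  path-bound : ∀ {u w} (pth : Path M u w) → pathLength pth < size M
  path-bound {u} pth with pathLength pth <? size M
  ... | yes lt = lt
  ... | no ¬lt with depth-path root-depth (reachable u)
  ...   | d , du with Finₚ.pigeonhole (s≤s (≮⇒≥ ¬lt)) (visit pth)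
  ...     | i , j , i<j , same = ⊥-elim (<⇒≢ i<j (+-cancelˡ-≡ d _ _
              (depth-unique (visit-depth du pth i) (subst (Depth _) (sym same) (visit-depth du pth j)))))

  successors : World M → List (World M)
  successors u = filter (λ v → R M u v ≟ᵇ true) (allFin (size M))

  ∈-successors⁻ : ∀ {u v} → v ∈ successors u → R M u v ≡ true
  ∈-successors⁻ m = proj₂ (∈-filter⁻ (λ v → R M _ v ≟ᵇ true) {xs = allFin (size M)} m)

  ∈-successors⁺ : ∀ {u v} → R M u v ≡ true → v ∈ successors u
  ∈-successors⁺ r = ∈-filter⁺ (λ v → R M _ v ≟ᵇ true) (∈-allFin _) r

  unravel : ℕ → World M → Tree
  unravel zero    u = node (V M u) []
  unravel (suc k) u = node (V M u) (map (unravel k) (successors u))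

module Similar (p : ℕ) (M : Model) where

  infix 4 _≈_

  data _≈_ : Tree → World M → Set where
    bisim : ∀ {v ts w} → (∀ q → q ≢ p → v q ≡ V M w q) →
            All (λ t → Σ[ u ∈ World M ] R M w u ≡ true × t ≈ u) ts →
            (∀ u → R M w u ≡ true → Any (_≈ u) ts) → node v ts ≈ w

  Succ : World M → Tree → Set
  Succ w t = Σ[ u ∈ World M ] R M w u ≡ true × t ≈ u

collect : ∀ {B : Set} {P : B → Set} {Q : X → B → Set} xs → All (λ x → Σ[ y ∈ B ] P y × Q x y) xs →
          Σ[ ys ∈ List B ] All P ys × All (λ x → Any (Q x) ys) xs
collect []       []                 = [] , [] , []
collect (x ∷ xs) ((y , py , qy) ∷ h) with collect xs h
... | ys , ps , qs = y ∷ ys , py ∷ ps , here qy ∷ All.map there qs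

module Completeness (p : ℕ) (M : Model) (K : IsKModel M) where
  open Interpolant p
  open Semantics M
  open KModel M K
  open Similar p M

  unravel-≈ : ∀ k u → (∀ {x} (pth : Path M u x) → pathLength pth < k) → unravel k u ≈ u
  unravel-≈ zero    u short = ⊥-elim (n≮0 (short stop))
  unravel-≈ (suc k) u short = bisim (λ _ _ → refl) (Allₚ.map⁺ (All.tabulate forth)) back
    where
    deeper : ∀ {v} → R M u v ≡ true → unravel k v ≈ v
    deeper r = unravel-≈ k _ (λ pth → ≤-pred (short (step r pth)))
    forth : ∀ {v} → v ∈ successors u → Succ u (unravel k v)
    forth m = _ , ∈-successors⁻ m , deeper (∈-successors⁻ m)
    back : ∀ v → R M u v ≡ true → Any (_≈ v) (map (unravel k) (successors u))
    back v r = Anyₚ.map⁺ (lose (∈-successors⁺ r) (deeper r))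

  copy : ∀ u → unravel (size M) u ≈ u
  copy u = unravel-≈ (size M) u path-bound

  cover : ∀ {P : Tree → Set} w → (∀ u → R M w u ≡ true → Σ[ t ∈ Tree ] P t × t ≈ u) →
          Σ[ ts ∈ List Tree ] All (λ t → Succ w t × P t) ts × (∀ u → R M w u ≡ true → Any (_≈ u) ts)
  cover w pick with collect (successors w) (All.tabulate λ {u} m → chosen (∈-successors⁻ m) (pick u (∈-successors⁻ m)))
    where
    chosen : ∀ {u} → R M w u ≡ true → Σ[ t ∈ Tree ] _ × t ≈ u → Σ[ t ∈ Tree ] (Succ w t × _) × t ≈ u
    chosen r (t , pt , s) = t , (( _ , r , s) , pt) , s
  ... | ts , ps , qs = ts , ps , λ u r → All.lookup qs (∈-successors⁺ r)

  data Refutation (I : Label → World M) : Label → Tree → Seq → Set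
  data Refutations (I : Label → World M) : (ℕ → Label) → List Tree → List Seq → Set

  data Refutation I where
    refutation : ∀ {σ t fs bs} → t ≈ I σ → Falsifiedᵗ fs t → Refutations I (σ *_) (children t) bs →
                 Refutation I σ t (seq fs bs)

  -- ts may continue beyond the trees refuting bs
  data Refutations I where
    []  : ∀ {f ts} → Refutations I f ts []
    _∷_ : ∀ {f t ts Δ bs} → Refutation I (f 1) t Δ → Refutations I (f ∘ suc) ts bs → Refutations I f (t ∷ ts) (Δ ∷ bs)

  refutations-++ : ∀ {I f ts bs} xs → Refutations I f ts bs → Refutations I f (ts ++ xs) bs
  refutations-++ xs []       = []
  refutations-++ xs (r ∷ rs) = r ∷ refutations-++ xs rs

  -- p is false exactly where the clause contains p; a clause also containing p̄ is excluded by clashF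
  pValue : Clause → Bool
  pValue c with Any.any? fvar-p? c
  ... | yes _ = false
  ... | no _  = true

  clauseValuation : World M → Clause → ℕ → Bool
  clauseValuation w c q with q ≟ p
  ... | yes _ = pValue c
  ... | no _  = V M w q

  clauseValuation-p : ∀ w c → clauseValuation w c p ≡ pValue c
  clauseValuation-p w c with p ≟ p
  ... | yes _   = refl
  ... | no p≢p  = ⊥-elim (p≢p refl)

  clauseValuation-≢p : ∀ w c {q} → q ≢ p → clauseValuation w c q ≡ V M w q
  clauseValuation-≢p w c {q} q≢p with q ≟ p
  ... | yes q≡p = ⊥-elim (q≢p q≡p)
  ... | no _    = refl

  pValue-false⁺ : ∀ {c} → fvar p ∈ c → pValue c ≡ false
  pValue-false⁺ {c} m with Any.any? fvar-p? c
  ... | yes _ = refl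
  ... | no ¬m = ⊥-elim (¬m m)

  pValue-false⁻ : ∀ c → pValue c ≡ false → fvar p ∈ c
  pValue-false⁻ c e with Any.any? fvar-p? c
  ... | yes m = m

  literalsF-complete : ∀ {w f c} → f ∈ c → PFree f → M , w ⊨ ⌜ f ⌝ → M , w ⊨ literalsF c
  literalsF-complete m free h = ⋁⁺ (lose (∈-map∘filter⁺ ⌜_⌝ pfree? (_ , m , refl , free)) h)

  clashF-complete : ∀ {w} c → Clash c → M , w ⊨ clashF c
  clashF-complete c cl with clash? c
  ... | yes _  = tt
  ... | no ¬cl = ¬cl cl

  clause-refuted : ∀ {w} c ts → ¬ (M , w ⊨ literalsF c) → ¬ (M , w ⊨ clashF c) →
                   All (Falsifiedᵗ (dias c)) ts → All (λ φ → Any (λ t → ¬ t ⊨ᵗ φ) ts) (boxes c) →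
                   Refutedᵗ (node (clauseValuation w c) ts) c
  clause-refuted {w} c ts ¬lit ¬clash rD rB = All.tabulate (refute _)
    where
    refute : ∀ f → f ∈ c → ¬ node (clauseValuation w c) ts ⊨ᵗ ⌜ f ⌝
    refute (fvar q) m h = case q ≟ p of λ where
      (yes refl) → case trans (sym (pValue-false⁺ m)) (trans (sym (clauseValuation-p w c)) h) of λ ()
      (no q≢p)   → ¬lit (literalsF-complete m q≢p (trans (sym (clauseValuation-≢p w c q≢p)) h))
    refute (fnvar q) m h = case q ≟ p of λ where
      (yes refl) → ¬clash (clashF-complete c (pValue-false⁻ c (trans (sym (clauseValuation-p w c)) h) , m))
      (no q≢p)   → ¬lit (literalsF-complete m q≢p (trans (sym (clauseValuation-≢p w c q≢p)) h))
    refute (fbox φ) m h with find (All.lookup rB (∈-boxes⁺ m))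
    ... | t , t∈ , ¬t = ¬t (All.lookup h t∈)
    refute (fdia D) m h with find h
    ... | t , t∈ , ht = All.lookup (All.lookup rD t∈) (∈-dias⁺ m) ht

  clause-bounded : ∀ {n c} fs → c ∈ cnfˢ fs → All (Bounded n) fs → All (Bounded n ∘ ⌜_⌝) c
  clause-bounded fs m b = All.tabulate λ f∈ → let (_ , φ∈ , s) = find (cnfˢ-⊑ fs m f∈) in ⊑-bounded s (All.lookup b φ∈)

  modal-bounded : ∀ {n} c → All (Bounded (suc n) ∘ ⌜_⌝) c → All (Bounded n) (dias c) × All (Bounded n) (boxes c)
  modal-bounded c b = All.tabulate (All.lookup b ∘ ∈-dias⁻ c) , All.tabulate (All.lookup b ∘ ∈-boxes⁻ c)

  dias-bounded : ∀ n c → All (Bounded n ∘ ⌜_⌝) c → All (Bounded n) (dias c)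
  dias-bounded zero    c b = All.tabulate (λ m → ⊥-elim (All.lookup b (∈-dias⁻ c m)))
  dias-bounded (suc n) c b = All.map (λ {D} → bounded-mono D (n≤1+n n)) (proj₁ (modal-bounded c b))

  clausesI-refuted : ∀ {n I σ} cs bs → ¬ (M , I ⊨ᵐ clausesI n σ cs bs) →
                     Σ[ c ∈ Clause ] c ∈ cs × ¬ (M , I ⊨ᵐ clauseI n σ c bs)
  clausesI-refuted []       bs ¬h = ⊥-elim (¬h tt)
  clausesI-refuted {n} {I} {σ} (c ∷ cs) bs ¬h with dec⊨ᵐ I (clauseI n σ c bs)
  ... | no ¬hc = c , here refl , ¬hc
  ... | yes hc with clausesI-refuted cs bs (λ h → ¬h (hc , h))
  ...   | c' , m , ¬hc' = c' , there m , ¬hc'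

  successorsF-refuted : ∀ {n w} Ds φs → ¬ (M , w ⊨ successorsF n Ds φs) →
                        All (λ φ → ¬ (M , w ⊨ □ᶠ (unlabel (nodeI n rootL (φ ∷ Ds) [])))) φs ×
                        ¬ (M , w ⊨ ◇ᶠ (unlabel (nodeI n rootL Ds [])))
  successorsF-refuted Ds []       ¬h = [] , ¬h
  successorsF-refuted Ds (φ ∷ φs) ¬h with successorsF-refuted Ds φs (¬h ∘ inj₂)
  ... | ¬□s , ¬◇ = (¬h ∘ inj₁) ∷ ¬□s , ¬◇

  mutual
    nodeI-complete : ∀ n {I σ} fs bs → Fits I (σ *_) σ bs → All (Bounded n) fs → Boundedˢ n bs →
                     ¬ (M , I ⊨ᵐ nodeI n σ fs bs) → Σ[ t ∈ Tree ] Refutation I σ t (seq fs bs)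
    nodeI-complete n fs bs F bfs bbs ¬h with clausesI-refuted (cnfˢ fs) bs ¬h
    ... | c , m , ¬hc with clauseI-complete n c bs F (clause-bounded fs m bfs) bbs ¬hc
    ...   | t , s , rc , rs = t , refutation s (refutedᵗ-cnfˢ fs m rc) rs

    clauseI-complete : ∀ n {I σ} c bs → Fits I (σ *_) σ bs → All (Bounded n ∘ ⌜_⌝) c → Boundedˢ n bs →
                       ¬ (M , I ⊨ᵐ clauseI n σ c bs) →
                       Σ[ t ∈ Tree ] t ≈ I σ × Refutedᵗ t c × Refutations I (σ *_) (children t) bs
    clauseI-complete n {I} {σ} c bs F bc bbs ¬h
      with boxesI-complete n (dias c) bs F (dias-bounded n c bc) bbs (¬h ∘ inj₂)
         | modalF-complete n (I σ) c bc (¬h ∘ inj₁ ∘ inj₂)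
    ... | ts , rs , ps | xs , ps' , rB , back =
      node (clauseValuation (I σ) c) (ts ++ xs) ,
      bisim (λ _ → clauseValuation-≢p (I σ) c) (Allₚ.++⁺ (All.map proj₁ ps) (All.map proj₁ ps'))
            (λ u r → Anyₚ.++⁺ʳ ts (back u r)) ,
      clause-refuted c (ts ++ xs) (¬h ∘ inj₁ ∘ inj₁ ∘ inj₁) (¬h ∘ inj₁ ∘ inj₁ ∘ inj₂)
        (Allₚ.++⁺ (All.map proj₂ ps) (All.map proj₂ ps')) (All.map (Anyₚ.++⁺ʳ ts) rB) ,
      refutations-++ xs rs

    leaf-complete : ∀ n v Ds → All (Bounded n) Ds → ¬ (M , v ⊨ unlabel (nodeI n rootL Ds [])) →
                    Σ[ t ∈ Tree ] Falsifiedᵗ Ds t × t ≈ v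
    leaf-complete n v Ds bD ¬h with nodeI-complete n {λ _ → v} {rootL} Ds [] tt bD tt (¬h ∘ unlabel⁺ (nodeI n rootL Ds []))
    ... | t , refutation s r _ = t , r , s

    modalF-complete : ∀ n w c → All (Bounded n ∘ ⌜_⌝) c → ¬ (M , w ⊨ modalF n c) →
                      Σ[ xs ∈ List Tree ] All (λ t → Succ w t × Falsifiedᵗ (dias c) t) xs ×
                        All (λ φ → Any (λ t → ¬ t ⊨ᵗ φ) xs) (boxes c) × (∀ u → R M w u ≡ true → Any (_≈ u) xs)
    modalF-complete zero w c bc _ with cover w (λ u _ → unravel (size M) u , no-dias , copy u)
      where
      no-dias : ∀ {t} → Falsifiedᵗ (dias c) t
      no-dias = All.tabulate (λ m → ⊥-elim (All.lookup bc (∈-dias⁻ c m)))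
    ... | xs , ps , back = xs , ps , All.tabulate (λ m → ⊥-elim (All.lookup bc (∈-boxes⁻ c m))) , back
    modalF-complete (suc n) w c bc ¬h with modal-bounded c bc | successorsF-refuted (dias c) (boxes c) ¬h
    ... | bD , bB | ¬□s , ¬◇
      with box-witnesses n w (dias c) (boxes c) bD bB ¬□s
         | cover w (λ u r → leaf-complete n u (dias c) bD (λ h → ¬◇ (u , r , h)))
    ... | ys , py , wit | zs , pz , back =
      ys ++ zs , Allₚ.++⁺ py pz , All.map Anyₚ.++⁺ˡ wit , λ u r → Anyₚ.++⁺ʳ ys (back u r)

    box-witnesses : ∀ n w Ds φs → All (Bounded n) Ds → All (Bounded n) φs →
                    All (λ φ → ¬ (M , w ⊨ □ᶠ (unlabel (nodeI n rootL (φ ∷ Ds) [])))) φs →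
                    Σ[ ys ∈ List Tree ] All (λ t → Succ w t × Falsifiedᵗ Ds t) ys × All (λ φ → Any (λ t → ¬ t ⊨ᵗ φ) ys) φs
    box-witnesses n w Ds φs bD bφs ¬□s = collect φs (All.zipWith witness (bφs , ¬□s))
      where
      witness : ∀ {φ} → Bounded n φ × ¬ (M , w ⊨ □ᶠ (unlabel (nodeI n rootL (φ ∷ Ds) []))) →
                Σ[ t ∈ Tree ] (Succ w t × Falsifiedᵗ Ds t) × ¬ t ⊨ᵗ φ
      witness (bφ , ¬□) with ¬□⇒◇¬ w _ ¬□
      ... | v , r , ¬h with leaf-complete n v _ (bφ ∷ bD) ¬h
      ...   | t , ¬φ ∷ ¬Ds , s = t , ((v , r , s) , ¬Ds) , ¬φ

    boxesI-complete : ∀ n {I f σ} Ds bs → Fits I f σ bs → All (Bounded n) Ds → Boundedˢ n bs →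
                      ¬ (M , I ⊨ᵐ boxesI n f σ Ds bs) →
                      Σ[ ts ∈ List Tree ] Refutations I f ts bs × All (λ t → Succ (I σ) t × Falsifiedᵗ Ds t) ts
    boxesI-complete n Ds [] _ _ _ _ = [] , [] , []
    boxesI-complete n {I} {f} Ds (seq gs cs ∷ bs) (r , Fc , Fbs) bD (bgs , bcs , bbs) ¬h
      with nodeI-complete n (gs ++ Ds) cs Fc (Allₚ.++⁺ bgs bD) bcs (¬h ∘ inj₁)
         | boxesI-complete n Ds bs Fbs bD bbs (¬h ∘ inj₂)
    ... | t , refutation s ¬gsDs rt | ts , rs , ps =
      t ∷ ts , refutation s (Allₚ.++⁻ˡ gs ¬gsDs) rt ∷ rs , ((I (f 1) , r , s) , Allₚ.++⁻ʳ gs ¬gsDs) ∷ ps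

subtree : Tree → List ℕ → Maybe Tree
subtree t               []      = just t
subtree (node v ts) (i ∷ π) with at ts i
... | nothing = nothing
... | just t' = subtree t' π

subtree-snoc : ∀ t π {v ts} k → subtree t π ≡ just (node v ts) → subtree t (π ++ [ k ]) ≡ at ts k
subtree-snoc t [] {ts = ts} k refl with at ts k
... | nothing = refl
... | just _  = refl
subtree-snoc (node v ts) (i ∷ π) k e with at ts i
... | just t' = subtree-snoc t' π k e

subtree-prefix : ∀ t π ρ {t'} → subtree t (π ++ ρ) ≡ just t' → Σ[ t'' ∈ Tree ] subtree t π ≡ just t''
subtree-prefix t [] ρ e = t , refl
subtree-prefix (node v ts) (i ∷ π) ρ e with at ts i
... | just t' = subtree-prefix t' π ρ e

mutual
  positions : Tree → List (List ℕ)
  positions (node _ ts) = [] ∷ positionsFrom 1 ts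

  positionsFrom : ℕ → List Tree → List (List ℕ)
  positionsFrom k []       = []
  positionsFrom k (t ∷ ts) = map (k ∷_) (positions t) ++ positionsFrom (suc k) ts

∈-positionsFrom⁺ : ∀ k ts j {t π} → at ts (suc j) ≡ just t → π ∈ positions t → (k + j) ∷ π ∈ positionsFrom k ts
∈-positionsFrom⁺ k (t ∷ ts) zero    refl m rewrite +-identityʳ k = ∈-++⁺ˡ (∈-map⁺ (k ∷_) m)
∈-positionsFrom⁺ k (t ∷ ts) (suc j) e    m rewrite +-suc k j =
  ∈-++⁺ʳ (map (k ∷_) (positions t)) (∈-positionsFrom⁺ (suc k) ts j e m)

∈-positionsFrom⁻ : ∀ k ts {y} → y ∈ positionsFrom k ts →
                   Σ[ j ∈ ℕ ] Σ[ π ∈ List ℕ ] Σ[ t ∈ Tree ] y ≡ (k + j) ∷ π × at ts (suc j) ≡ just t × π ∈ positions t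
∈-positionsFrom⁻ k (t ∷ ts) m with ∈-++⁻ (map (k ∷_) (positions t)) m
... | inj₁ m' with ∈-map⁻ (k ∷_) m'
...   | π , mπ , refl = 0 , π , t , cong (_∷ π) (sym (+-identityʳ k)) , refl , mπ
∈-positionsFrom⁻ k (t ∷ ts) m | inj₂ m' with ∈-positionsFrom⁻ (suc k) ts m'
...   | j , π , t' , refl , e , mπ = suc j , π , t' , cong (_∷ π) (sym (+-suc k j)) , e , mπ

∈-positions⁺ : ∀ t π {t'} → subtree t π ≡ just t' → π ∈ positions t
∈-positions⁺ (node _ _)  []          e = here refl
∈-positions⁺ (node v ts) (zero ∷ π)  e with at ts 0 in eq
... | just _  = ⊥-elim (at-zero ts eq)
∈-positions⁺ (node v ts) (suc j ∷ π) e with at ts (suc j) in eq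
... | just t' = there (∈-positionsFrom⁺ 1 ts j eq (∈-positions⁺ t' π e))

∈-positions⁻ : ∀ t π → π ∈ positions t → Σ[ t' ∈ Tree ] subtree t π ≡ just t'
∈-positions⁻ t           []      _         = t , refl
∈-positions⁻ (node v ts) (i ∷ π) (there m) with ∈-positionsFrom⁻ 1 ts m
... | j , π , t' , refl , e , mπ rewrite e = ∈-positions⁻ t' π mπ

positionsFrom-heads : ∀ k ts → All (λ y → Σ[ h ∈ ℕ ] Σ[ π ∈ List ℕ ] y ≡ h ∷ π × k ≤ h) (positionsFrom k ts)
positionsFrom-heads k []       = []
positionsFrom-heads k (t ∷ ts) =
  Allₚ.++⁺ (Allₚ.map⁺ (All.tabulate λ _ → k , _ , refl , ≤-refl))
           (All.map (λ (h , π , e , le) → h , π , e , ≤-trans (n≤1+n k) le) (positionsFrom-heads (suc k) ts))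

mutual
  positions-unique : ∀ t → Unique (positions t)
  positions-unique (node _ ts) =
    All.map (λ { (_ , _ , refl , _) () }) (positionsFrom-heads 1 ts) ∷ positionsFrom-unique 1 ts

  positionsFrom-unique : ∀ k ts → Unique (positionsFrom k ts)
  positionsFrom-unique k []       = []
  positionsFrom-unique k (t ∷ ts) =
    Uniqueₚ.++⁺ (Uniqueₚ.map⁺ (λ { refl → refl }) (positions-unique t)) (positionsFrom-unique (suc k) ts) disjoint
    where
    disjoint : ∀ {y} → ¬ (y ∈ map (k ∷_) (positions t) × y ∈ positionsFrom (suc k) ts)
    disjoint (m , m') with ∈-map⁻ (k ∷_) m | All.lookup (positionsFrom-heads (suc k) ts) m'
    ... | _ , _ , refl | _ , _ , refl , le = <-irrefl refl le

lookup-injective : ∀ {xs : List X} → Unique xs → ∀ i j → lookup xs i ≡ lookup xs j → i ≡ j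
lookup-injective (_ ∷ u)  Fin.zero    Fin.zero    e = refl
lookup-injective (px ∷ _) Fin.zero    (Fin.suc j) e = ⊥-elim (All.lookup px (∈-lookup j) e)
lookup-injective (px ∷ _) (Fin.suc i) Fin.zero    e = ⊥-elim (All.lookup px (∈-lookup i) (sym e))
lookup-injective (_ ∷ u)  (Fin.suc i) (Fin.suc j) e = cong Fin.suc (lookup-injective u i j e)

isChild : List ℕ → List ℕ → Bool
isChild []      (_ ∷ [])    = true
isChild []      _           = false
isChild (_ ∷ _) []          = false
isChild (a ∷ π) (b ∷ ρ) with a ≟ b
... | yes _ = isChild π ρ
... | no _  = false

isChild-snoc : ∀ π k → isChild π (π ++ [ k ]) ≡ true
isChild-snoc []      k = refl
isChild-snoc (a ∷ π) k with a ≟ a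
... | yes _   = isChild-snoc π k
... | no a≢a  = ⊥-elim (a≢a refl)

isChild-sound : ∀ π ρ → isChild π ρ ≡ true → Σ[ k ∈ ℕ ] ρ ≡ π ++ [ k ]
isChild-sound []      (k ∷ []) e = k , refl
isChild-sound (a ∷ π) (b ∷ ρ)  e with a ≟ b
... | yes refl with isChild-sound π ρ e
...   | k , refl = k , refl

isChild-[] : ∀ π → isChild π [] ≡ false
isChild-[] []      = refl
isChild-[] (_ ∷ _) = refl

isChild-irreflexive : ∀ π → isChild π π ≡ false
isChild-irreflexive π with isChild π π in e
... | false = refl
... | true with isChild-sound π π e
...   | k , e' = ⊥-elim (<-irrefl (cong length e') (subst (length π <_) (sym (length-++ π)) (m<m+n _ z<s)))

module TreeModel (t : Tree) where

  P : List (List ℕ)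
  P = positions t

  valueAt : Maybe Tree → ℕ → Bool
  valueAt nothing   _ = false
  valueAt (just t') = valuation t'

  model : Model
  model = record { size = length P ; R = λ x y → isChild (lookup P x) (lookup P y) ; V = λ x → valueAt (subtree t (lookup P x)) }

  W : Set
  W = World model

  index : ∀ {π} → π ∈ P → W
  index = Any.index

  lookup-index : ∀ {π} (m : π ∈ P) → lookup P (index m) ≡ π
  lookup-index m = sym (Anyₚ.lookup-index m)

  lookup-injective-P : ∀ {x y : W} → lookup P x ≡ lookup P y → x ≡ y
  lookup-injective-P = lookup-injective (positions-unique t) _ _

  index-lookup : ∀ x → Σ[ t' ∈ Tree ] subtree t (lookup P x) ≡ just t'
  index-lookup x = ∈-positions⁻ t _ (∈-lookup x)

  child-world : ∀ {x v ts k c} → subtree t (lookup P x) ≡ just (node v ts) → at ts k ≡ just c →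
                Σ[ y ∈ W ] lookup P y ≡ lookup P x ++ [ k ] × R model x y ≡ true × subtree t (lookup P y) ≡ just c
  child-world {x} {k = k} {c} e ek with trans (subtree-snoc t (lookup P x) k e) ek
  ... | e' = index m , lookup-index m ,
             subst (λ π → isChild (lookup P x) π ≡ true) (sym (lookup-index m)) (isChild-snoc (lookup P x) k) ,
             subst (λ π → subtree t π ≡ just c) (sym (lookup-index m)) e'
    where m = ∈-positions⁺ t _ e'

  parent-world : ∀ {x y v ts} → R model x y ≡ true → subtree t (lookup P x) ≡ just (node v ts) →
                 Σ[ c ∈ Tree ] c ∈ ts × subtree t (lookup P y) ≡ just c
  parent-world {x} {y} {ts = ts} r e with isChild-sound (lookup P x) (lookup P y) r | index-lookup y
  ... | k , ey | c , ec =
    c , at-∈ ts k (trans (sym (subtree-snoc t (lookup P x) k e)) (subst (λ π → subtree t π ≡ just c) ey ec)) , ec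

  rootW : W
  rootW = index (∈-positions⁺ t [] refl)

  position : List ℕ → W
  position π with DecMembership._∈?_ (≡-dec _≟_) π P
  ... | yes m = index m
  ... | no _  = rootW

  position-lookup : ∀ {π} → π ∈ P → lookup P (position π) ≡ π
  position-lookup {π} m with DecMembership._∈?_ (≡-dec _≟_) π P
  ... | yes m' = lookup-index m'
  ... | no ¬m  = ⊥-elim (¬m m)

  -- the node labelled 1 ∷ π goes to the tree position π; other labels are junk
  labelWorld : Label → W
  labelWorld []      = rootW
  labelWorld (_ ∷ π) = position π

  reach : ∀ ρ a {t'} → subtree t (lookup P a ++ ρ) ≡ just t' →
          Σ[ b ∈ W ] lookup P b ≡ lookup P a ++ ρ × Path model a b
  reach []      a e = a , sym (++-identityʳ _) , stop
  reach (k ∷ ρ) a {t'} e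
    with e' ← subst (λ π → subtree t π ≡ just t') (sym (++-assoc (lookup P a) [ k ] ρ)) e
    with subtree-prefix t (lookup P a ++ [ k ]) ρ e'
  ... | c , ec with subtree-prefix t (lookup P a) [ k ] ec
  ...   | node v ts , ea with child-world ea (trans (sym (subtree-snoc t (lookup P a) k ea)) ec)
  ...     | y , ly , r , _ with reach ρ y (subst (λ π → subtree t (π ++ ρ) ≡ just t') (sym ly) e')
  ...       | b , lb , pth = b , trans lb (trans (cong (_++ ρ) ly) (++-assoc (lookup P a) [ k ] ρ)) , step r pth

  isKModel : IsKModel model
  isKModel = record
    { root         = rootW
    ; root-no-pred = λ w → subst (λ π → isChild (lookup P w) π ≡ false) (sym (lookup-index _)) (isChild-[] (lookup P w))
    ; reachable    = reachable
    ; unique-pred  = unique-pred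
    ; irreflexive  = λ w → isChild-irreflexive (lookup P w)
    ; intransitive = intransitive
    }
    where
    reachable : ∀ w → Path model rootW w
    reachable w with index-lookup w
    ... | t' , e with reach (lookup P w) rootW (subst (λ π → subtree t (π ++ lookup P w) ≡ just t') (sym (lookup-index _)) e)
    ...   | b , lb , pth = subst (Path model rootW) (lookup-injective-P (trans lb (cong (_++ lookup P w) (lookup-index _)))) pth

    unique-pred : ∀ u v w → R model u w ≡ true → R model v w ≡ true → u ≡ v
    unique-pred u v w r r' with isChild-sound _ _ r | isChild-sound _ _ r'
    ... | _ , e | _ , e' = lookup-injective-P (proj₁ (∷ʳ-injective (lookup P u) (lookup P v) (trans (sym e) e')))

    intransitive : ∀ u v w → R model u v ≡ true → R model v w ≡ true → R model u w ≡ false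
    intransitive u v w r r' with R model u w in e
    ... | false = refl
    ... | true with unique-pred u v w e r'
    ...   | refl = trans (sym r) (isChild-irreflexive (lookup P u))

  truth : ∀ x {t'} → subtree t (lookup P x) ≡ just t' → ∀ φ → model , x ⊨ φ → t' ⊨ᵗ φ
  truth x e ⊥ᶠ       h = h
  truth x e ⊤ᶠ       h = h
  truth x e (var q)  h rewrite e = h
  truth x e (nvar q) h rewrite e = h
  truth x e (φ ∧ᶠ ψ) (a , b)  = truth x e φ a , truth x e ψ b
  truth x e (φ ∨ᶠ ψ) (inj₁ a) = inj₁ (truth x e φ a)
  truth x e (φ ∨ᶠ ψ) (inj₂ b) = inj₂ (truth x e ψ b)
  truth x {node v ts} e (□ᶠ φ) h = All.tabulate λ c∈ →
    let (k , ek) = ∈-at c∈ ; (y , _ , r , ey) = child-world e ek in truth y ey φ (h y r)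
  truth x {node v ts} e (◇ᶠ φ) (y , r , hy) with parent-world r e
  ... | c , c∈ , ey = lose c∈ (truth y ey φ hy)

module TreeBisimulation (p : ℕ) (M : Model) (t : Tree) where
  open Similar p M
  open TreeModel t

  Z : W → World M → Set
  Z x w = Σ[ t' ∈ Tree ] subtree t (lookup P x) ≡ just t' × t' ≈ w

  bisimulation : ∀ {x w} → Z x w → IsBisimUpTo p model M Z
  bisimulation {x} {w} z = record
    { nonempty = x , w , z
    ; atoms    = λ { (node _ _ , e , bisim agree _ _) q q≢p → trans (cong (λ s → valueAt s q) e) (agree q q≢p) }
    ; forth    = forth
    ; back     = back
    }
    where
    forth : ∀ {x w y} → Z x w → R model x y ≡ true → Σ[ u ∈ World M ] R M w u ≡ true × Z y u
    forth (node _ _ , e , bisim _ fw _) r with parent-world r e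
    ... | c , c∈ , ec with All.lookup fw c∈
    ...   | u , ru , s = u , ru , c , ec , s
    back : ∀ {x w u} → Z x w → R M w u ≡ true → Σ[ y ∈ W ] R model x y ≡ true × Z y u
    back (node _ _ , e , bisim _ _ bk) r with find (bk _ r)
    ... | c , c∈ , s with child-world e (proj₂ (∈-at c∈))
    ...   | y , _ , r' , ey = y , r' , c , ey , s

module Countermodel (p : ℕ) (M : Model) (K : IsKModel M) (I : Label → World M) where
  open Similar p M
  open Completeness p M K using (Refutation; Refutations; refutation; []; _∷_)

  refutations-at : ∀ {f ts bs i} → Refutations I f ts bs → ith bs i ≡ just Δ →
                   Σ[ t ∈ Tree ] at ts i ≡ just t × Refutation I (f i) t Δ
  refutations-at {bs = []}    []       ()
  refutations-at {i = zero}    (_ ∷ _)  ()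
  refutations-at {i = suc zero}    (r ∷ _)  refl = _ , refl , r
  refutations-at {i = suc (suc i)} (_ ∷ rs) e    = refutations-at {i = suc i} rs e

  refutation-at : ∀ {t₀ Δ₀} → Refutation I σ t₀ Δ₀ → NodeAt Δ₀ π Δ →
                  Σ[ t ∈ Tree ] subtree t₀ π ≡ just t × Refutation I (σ ++ π) t Δ
  refutation-at {σ} {t₀ = t₀} ρ here = t₀ , refl , subst (λ τ → Refutation I τ t₀ _) (sym (++-identityʳ σ)) ρ
  refutation-at {σ} {t₀ = node v ts} (refutation _ _ rs) (there {i = i} {is = π} e n)
    with refutations-at rs e
  ... | t₁ , e₁ , ρ₁ with refutation-at ρ₁ n
  ...   | t , e' , ρ rewrite e₁ = t , e' , subst (λ τ → Refutation I τ t _) (++-assoc σ [ i ] π) ρ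

  countermodel : ∀ {t} → Refutation I rootL t Γ →
                 Σ[ M' ∈ Model ] IsKModel M' × Σ[ I' ∈ (Label → World M') ]
                   IsInterp Γ M' I' × Bisim~ p Γ M' I' M I × ¬ (M' , I' ⊨ˢ Γ)
  countermodel {Γ} {t} ρ =
    model , isKModel , labelWorld , interp , (Z , bisimulation (related rootL (_ , root-at)) , related) , refuted
    where
    open TreeModel t
    open TreeBisimulation p M t

    node-at : At Γ σ Δ → Σ[ t' ∈ Tree ] subtree t (lookup P (labelWorld σ)) ≡ just t' × Refutation I σ t' Δ
    node-at (π , refl , n) with refutation-at ρ n
    ... | t' , e , ρ' = t' , subst (λ π → subtree t π ≡ just t') (sym (position-lookup (∈-positions⁺ t π e))) e , ρ'

    interp : IsInterp Γ model labelWorld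
    interp _ n (_ , π , refl , na) (_ , _ , refl , na') with refutation-at ρ na | refutation-at ρ na'
    ... | _ , e , _ | _ , e' , _ =
      subst₂ (λ a b → isChild a b ≡ true) (sym (position-lookup (∈-positions⁺ t π e)))
             (sym (position-lookup (∈-positions⁺ t _ e'))) (isChild-snoc π n)

    related : ∀ σ → InL Γ σ → Z (labelWorld σ) (I σ)
    related σ (_ , a) with node-at a
    ... | t' , e , refutation s _ _ = t' , e , s

    refuted : ¬ (model , labelWorld ⊨ˢ Γ)
    refuted (σ , φ , (_ , a , m) , h) with node-at a
    ... | t' , e , refutation _ r _ = All.lookup r m (truth (labelWorld σ) e φ h)

interpolant : ℕ → Seq → MF
interpolant p (seq fs bs) = Interpolant.nodeI p (depthᶠ fs ⊔ depthˢ bs) rootL fs bs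

interpolant-vars : ∀ Γ p q → OccMF q (interpolant p Γ) → OccSeq q Γ × q ≢ p
interpolant-vars (seq fs bs) p q o with Vocabulary.nodeI-occ p _ rootL fs bs o
... | q≢p , occ = somewhere-formula root-at occ , q≢p

interpolant-labels : ∀ Γ p σ → LabMF σ (interpolant p Γ) → InL Γ σ
interpolant-labels (seq fs bs) p σ l with somewhere-at root-at (Vocabulary.nodeI-lab p _ rootL fs bs l)
... | _ , Δ , a , refl = Δ , a

interpolant-sound : ∀ Γ p M → IsKModel M → ∀ I → IsInterp Γ M I → M , I ⊨ᵐ interpolant p Γ → M , I ⊨ˢ Γ
interpolant-sound (seq fs bs) p M _ I = Soundness.nodeI-sound-root p M _ fs bs

interpolant-complete : ∀ Γ p M → IsKModel M → ∀ I → IsInterp Γ M I → ¬ (M , I ⊨ᵐ interpolant p Γ) →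
                       Σ[ M' ∈ Model ] IsKModel M' × Σ[ I' ∈ (Label → World M') ]
                         IsInterp Γ M' I' × Bisim~ p Γ M' I' M I × ¬ (M' , I' ⊨ˢ Γ)
interpolant-complete (seq fs bs) p M K I ii ¬h =
  Countermodel.countermodel p M K I
    (Completeness.nodeI-complete p M K _ fs bs (Semantics.fits-root M ii)
      (bounded-depthᶠ fs (m≤m⊔n _ _)) (bounded-depthˢ bs (m≤n⊔m _ _)) ¬h .proj₂)

theorem4 : BNUIP IsKModel
theorem4 Γ p = interpolant p Γ , (interpolant-vars Γ p , interpolant-labels Γ p) ,
               interpolant-sound Γ p , interpolant-complete Γ p
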